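{- Fix a positive integer $j$ and let $f(x)=\sum_P x^{\mathrm{size}(P)}$, the sum over all $j$-Dyck paths $P$. Then \[ \Phi\big(f(x)\big)=\sum_P x^{\mathrm{size}(P)}y^{\mathrm{npa}_j(P)}, \] the sum over all $j$-Dyck paths, where $\mathrm{npa}_j(P)$ is the number of $j$-nice pyramid ascents of $P$.
   Context: The run transform is $\Phi\big(f(x)\big)=\frac{1-x}{1-xy}\,f\!\left(\frac{x(1-x)}{1-xy}\right)$. A Dyck path is a lattice path of upsteps $U=(1,1)$ and downsteps $D=(1,-1)$ from height $0$ to height $0$ never going below height $0$. An ascent is a maximal subpath of the form $U^k$ ($k\ge1$); a pyramid is a maximal subpath $U^kD^k$ ($k\ge1$); a pyramid ascent is an ascent that is the first half of a pyramid. A $j$-Dyck path is a Dyck path in which every ascent has length divisible by $j$; its size is (number of downsteps)$/j$. A pyramid ascent is $j$-nice if it ends at a height divisible by $j$. -}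

module Defs where

open import Data.Bool using (Bool; true; false; _∧_; not; if_then_else_)
open import Data.Nat using (ℕ; zero; suc; _+_; _*_; _∸_; _≤ᵇ_; _≡ᵇ_; NonZero)
open import Data.Nat.DivMod using (_/_; _%_)
open import Data.List using (List; []; _∷_; map; length; _++_)

filterB : {A : Set} → (A → Bool) → List A → List A
filterB P [] = []
filterB P (a ∷ as) = if P a then a ∷ filterB P as else filterB P as
open import Data.Product using (_×_; _,_)
open import Data.Integer using (ℤ; +_; -[1+_]) renaming (_+_ to _+ℤ_; _*_ to _*ℤ_)

-- Formal power series in two variables x, y with integer coefficients,
-- represented by their coefficient function:  F n m = [x^n y^m] F.

Series : Set
Series = ℕ → ℕ → ℤ

sumTo : ℕ → (ℕ → ℤ) → ℤ
sumTo zero    g = g zero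
sumTo (suc n) g = sumTo n g +ℤ g (suc n)

infixl 7 _⊛_
_⊛_ : Series → Series → Series
(A ⊛ B) n m = sumTo n λ i → sumTo m λ l → A i l *ℤ B (n ∸ i) (m ∸ l)

oneS : Series
oneS zero zero = + 1
oneS _    _    = + 0

xS : Series
xS (suc zero) zero = + 1
xS _          _    = + 0

oneMinusX : Series
oneMinusX zero       zero = + 1
oneMinusX (suc zero) zero = -[1+ 0 ]
oneMinusX _          _    = + 0

invOneMinusXY : Series
invOneMinusXY n m = if n ≡ᵇ m then + 1 else + 0

powS : Series → ℕ → Series
powS S zero    = oneS
powS S (suc k) = S ⊛ powS S k

-- substitution f(S) of a series S with zero x-constant term into a
-- univariate power series f (given by its coefficients f k = [x^k] f):
-- [x^n y^m] f(S) = Σ_{k ≤ n} f k · [x^n y^m] S^k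
-- (terms with k > n contribute nothing since S^k is divisible by x^k).
substS : (ℕ → ℤ) → Series → Series
substS f S n m = sumTo n λ k → f k *ℤ powS S k n m

runArg : Series
runArg = (xS ⊛ oneMinusX) ⊛ invOneMinusXY

Φ : (ℕ → ℤ) → Series
Φ f = (oneMinusX ⊛ invOneMinusXY) ⊛ substS f runArg

-- Lattice paths: a list of steps, true = U = (1,1), false = D = (1,-1).

Path : Set
Path = List Bool

allPaths : ℕ → List Path
allPaths zero    = [] ∷ []
allPaths (suc n) = map (true ∷_) (allPaths n) ++ map (false ∷_) (allPaths n)

dyckFrom : ℕ → Path → Bool
dyckFrom h       []          = h ≡ᵇ 0
dyckFrom h       (true ∷ p)  = dyckFrom (suc h) p
dyckFrom zero    (false ∷ p) = false
dyckFrom (suc h) (false ∷ p) = dyckFrom h p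

isDyck : Path → Bool
isDyck = dyckFrom 0

sameStep : Bool → Bool → Bool
sameStep true  true  = true
sameStep false false = true
sameStep _     _     = false

runs : Path → List (Bool × ℕ)
runs []      = []
runs (b ∷ p) with runs p
... | []             = (b , 1) ∷ []
... | (c , k) ∷ rs = if sameStep b c then (c , suc k) ∷ rs else (b , 1) ∷ (c , k) ∷ rs

numDown : Path → ℕ
numDown p = length (filterB not p)

ascentsDivisible : (j : ℕ) → .{{NonZero j}} → List (Bool × ℕ) → Bool
ascentsDivisible j []               = true
ascentsDivisible j ((true , k) ∷ r)  = (k % j ≡ᵇ 0) ∧ ascentsDivisible j r
ascentsDivisible j ((false , k) ∷ r) = ascentsDivisible j r

isJDyck : (j : ℕ) → .{{NonZero j}} → Path → Bool
isJDyck j p = isDyck p ∧ ascentsDivisible j (runs p)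

size : (j : ℕ) → .{{NonZero j}} → Path → ℕ
size j p = numDown p / j

-- An ascent U^k followed by the maximal descent D^d is the first half of
-- the (maximal) pyramid U^{min(k,d)} D^{min(k,d)}; so it is a pyramid
-- ascent iff k ≤ d.  It is j-nice iff it ends at height h + k ≡ 0 (mod j).
npaFrom : (j : ℕ) → .{{NonZero j}} → ℕ → List (Bool × ℕ) → ℕ
npaFrom j h [] = 0
npaFrom j h ((true , k) ∷ (false , d) ∷ r) =
  (if (k ≤ᵇ d) ∧ ((h + k) % j ≡ᵇ 0) then 1 else 0)
  + npaFrom j ((h + k) ∸ d) r
npaFrom j h ((true , k) ∷ r) = npaFrom j (h + k) r
npaFrom j h ((false , d) ∷ r) = npaFrom j (h ∸ d) r

npa : (j : ℕ) → .{{NonZero j}} → Path → ℕ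
npa j p = npaFrom j 0 (runs p)

-- Generating functions.  A j-Dyck path of size n has exactly j n
-- downsteps and j n upsteps, hence length 2 j n, so enumerating step
-- sequences of length 2 j n finds all of them.

jDyckCount : (j : ℕ) → .{{NonZero j}} → ℕ → ℤ
jDyckCount j n =
  + length (filterB (λ p → isJDyck j p ∧ (size j p ≡ᵇ n)) (allPaths (2 * j * n)))

npaSeries : (j : ℕ) → .{{NonZero j}} → Series
npaSeries j n m =
  + length (filterB (λ p → isJDyck j p ∧ (size j p ≡ᵇ n) ∧ (npa j p ≡ᵇ m))
                       (allPaths (2 * j * n)))

-- Write W = (1 - x)/(1 - xy). Then Φ f = W · f(xW), so [x^n y^m] Φ f = Σ_k f_k · [x^(n-k) y^m] W^(k+1).
--
-- Read paths with an automaton that tracks the height, the length of the current ascent and whether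
-- the previous step was a down-step. Call the start, and every point reached by a down-step, a slot
-- when its height is divisible by j: a j-Dyck path of size k has k + 1 slots, and a j-nice pyramid
-- ascent is exactly a pyramid U^(jt) D^(jt) starting at a slot. By strong induction on the length L,
-- simultaneously for all automaton states, the number of accepted paths of length L with m nice
-- pyramid ascents is Σ_Q [x^((L - |Q|)/2j) y^m] W^(slots Q), summed over accepted paths Q. Away from
-- slots both sides just follow the first step. At a slot, taking off one U^j … D^j of a leading
-- pyramid gives the counts the same recurrence that (1 - xy) W^(s+1) = (1 - x) W^s gives the
-- right-hand side. For the initial state and L = 2jn the right-hand side is [x^n y^m] Φ f.

module Submission where

open import Defs
open import Data.Bool using (Bool; true; false; if_then_else_; _∧_; not; T)
import Data.Bool.Properties as BoolP
open import Data.Empty using (⊥-elim)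
open import Data.Integer as ℤ using (ℤ; 0ℤ; 1ℤ; _+_; _-_; _*_; -_)
import Data.Integer.Properties as ℤP
open import Data.Integer.Tactic.RingSolver using (solve-∀)
open import Data.List using (List; []; _∷_; map; length; _++_)
open import Data.Nat as ℕ using (ℕ; NonZero; zero; suc; _∸_; _≤_; _<_; z≤n; s≤s; _≡ᵇ_; _%_; _/_)
import Data.Nat.DivMod as ℕDM
open import Data.Nat.Induction using (<-rec)
import Data.Nat.Properties as ℕP
import Data.Nat.Tactic.RingSolver as ℕSolver
open import Data.Product using (_×_; _,_; proj₁; proj₂)
open import Data.Sum using (inj₁; inj₂)
open import Function using (_∘_)
open import Relation.Binary.Bundles using (Setoid)
open import Relation.Binary.PropositionalEquality
open import Relation.Nullary using (yes; no)

-- Finite sums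

sumTo-cong≤ : ∀ n {f g : ℕ → ℤ} → (∀ i → i ≤ n → f i ≡ g i) → sumTo n f ≡ sumTo n g
sumTo-cong≤ zero    f≗g = f≗g 0 z≤n
sumTo-cong≤ (suc n) f≗g =
  cong₂ _+_ (sumTo-cong≤ n (λ i i≤n → f≗g i (ℕP.m≤n⇒m≤1+n i≤n))) (f≗g (suc n) ℕP.≤-refl)

sumTo-cong : ∀ n {f g : ℕ → ℤ} → (∀ i → f i ≡ g i) → sumTo n f ≡ sumTo n g
sumTo-cong n f≗g = sumTo-cong≤ n (λ i _ → f≗g i)

sumTo-zero : ∀ n {f : ℕ → ℤ} → (∀ i → i ≤ n → f i ≡ 0ℤ) → sumTo n f ≡ 0ℤ
sumTo-zero zero    f≗0 = f≗0 0 z≤n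
sumTo-zero (suc n) f≗0 =
  cong₂ _+_ (sumTo-zero n (λ i i≤n → f≗0 i (ℕP.m≤n⇒m≤1+n i≤n))) (f≗0 (suc n) ℕP.≤-refl)

sumTo-+ : ∀ n (f g : ℕ → ℤ) → sumTo n (λ i → f i + g i) ≡ sumTo n f + sumTo n g
sumTo-+ zero    f g = refl
sumTo-+ (suc n) f g = trans (cong (_+ (f (suc n) + g (suc n))) (sumTo-+ n f g))
                            (interchange (sumTo n f) (sumTo n g) (f (suc n)) (g (suc n)))
  where
  interchange : ∀ a b c d → a + b + (c + d) ≡ a + c + (b + d)
  interchange = solve-∀

sumTo-*ˡ : ∀ n c (f : ℕ → ℤ) → sumTo n (λ i → c * f i) ≡ c * sumTo n f
sumTo-*ˡ zero    c f = refl
sumTo-*ˡ (suc n) c f = trans (cong (_+ c * f (suc n)) (sumTo-*ˡ n c f)) (sym (ℤP.*-distribˡ-+ c _ _))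

sumTo-*ʳ : ∀ n c (f : ℕ → ℤ) → sumTo n (λ i → f i * c) ≡ sumTo n f * c
sumTo-*ʳ n c f =
  trans (sumTo-cong n (λ i → ℤP.*-comm (f i) c)) (trans (sumTo-*ˡ n c f) (ℤP.*-comm c _))

sumTo-neg : ∀ n (f : ℕ → ℤ) → sumTo n (λ i → - f i) ≡ - sumTo n f
sumTo-neg zero    f = refl
sumTo-neg (suc n) f =
  trans (cong (_+ - f (suc n)) (sumTo-neg n f)) (sym (ℤP.neg-distrib-+ (sumTo n f) (f (suc n))))

sumTo-sucˡ : ∀ n (f : ℕ → ℤ) → sumTo (suc n) f ≡ f 0 + sumTo n (f ∘ suc)
sumTo-sucˡ zero    f = refl
sumTo-sucˡ (suc n) f = trans (cong (_+ f (suc (suc n))) (sumTo-sucˡ n f)) (ℤP.+-assoc (f 0) _ _)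

sumTo-only₀ : ∀ n {f : ℕ → ℤ} → (∀ i → i < n → f (suc i) ≡ 0ℤ) → sumTo n f ≡ f 0
sumTo-only₀ zero    _   = refl
sumTo-only₀ (suc n) {f} f≗0 =
  trans (sumTo-sucˡ n f)
        (trans (cong (f 0 +_) (sumTo-zero n (λ i i≤n → f≗0 i (s≤s i≤n)))) (ℤP.+-identityʳ _))

sumTo-only₁ : ∀ n {f : ℕ → ℤ} → f 0 ≡ 0ℤ → (∀ i → i < n → f (suc (suc i)) ≡ 0ℤ) →
              sumTo (suc n) f ≡ f 1
sumTo-only₁ n {f} f0≡0 f≗0 =
  trans (sumTo-sucˡ n f) (trans (cong₂ _+_ f0≡0 (sumTo-only₀ n f≗0)) (ℤP.+-identityˡ _))

sumTo-swap : ∀ n m (F : ℕ → ℕ → ℤ) →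
             sumTo n (λ i → sumTo m (F i)) ≡ sumTo m (λ l → sumTo n (λ i → F i l))
sumTo-swap zero    m F = refl
sumTo-swap (suc n) m F = trans (cong (_+ sumTo m (F (suc n))) (sumTo-swap n m F))
                               (sym (sumTo-+ m (λ l → sumTo n (λ i → F i l)) (F (suc n))))

sumTo-reverse : ∀ n (f : ℕ → ℤ) → sumTo n f ≡ sumTo n (λ i → f (n ∸ i))
sumTo-reverse zero    f = refl
sumTo-reverse (suc n) f =
  trans (cong (_+ f (suc n)) (sumTo-reverse n f))
        (trans (ℤP.+-comm _ (f (suc n))) (sym (sumTo-sucˡ n (λ i → f (suc n ∸ i)))))

sumTo-triangle : ∀ n (F : ℕ → ℕ → ℤ) →
                 sumTo n (λ i → sumTo i (λ k → F k i)) ≡ sumTo n (λ k → sumTo (n ∸ k) (λ t → F k (k ℕ.+ t)))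
sumTo-triangle zero    F = refl
sumTo-triangle (suc n) F =
  begin
    sumTo n (λ i → sumTo i (λ k → F k i)) + (sumTo n (λ k → F k (suc n)) + F (suc n) (suc n))
  ≡⟨ cong (_+ (sumTo n (λ k → F k (suc n)) + F (suc n) (suc n))) (sumTo-triangle n F) ⟩
    Rows n + (sumTo n (λ k → F k (suc n)) + F (suc n) (suc n))
  ≡⟨ sym (ℤP.+-assoc (Rows n) _ _) ⟩
    Rows n + sumTo n (λ k → F k (suc n)) + F (suc n) (suc n)
  ≡⟨ cong₂ _+_ (sym (sumTo-+ n _ _)) (cong (F (suc n)) (sym (ℕP.+-identityʳ (suc n)))) ⟩
    sumTo n (λ k → sumTo (n ∸ k) (λ t → F k (k ℕ.+ t)) + F k (suc n)) + F (suc n) (suc n ℕ.+ 0)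
  ≡⟨ cong (_+ F (suc n) (suc n ℕ.+ 0)) (sumTo-cong≤ n extendRow) ⟩
    sumTo n (λ k → sumTo (suc n ∸ k) (λ t → F k (k ℕ.+ t))) + F (suc n) (suc n ℕ.+ 0)
  ≡⟨ cong (λ d → sumTo n (λ k → sumTo (suc n ∸ k) (λ t → F k (k ℕ.+ t))) + sumTo d (λ t → F (suc n) (suc n ℕ.+ t))) (sym (ℕP.n∸n≡0 n)) ⟩
    sumTo (suc n) (λ k → sumTo (suc n ∸ k) (λ t → F k (k ℕ.+ t)))
  ∎
  where
  open ≡-Reasoning
  Rows : ℕ → ℤ
  Rows n = sumTo n (λ k → sumTo (n ∸ k) (λ t → F k (k ℕ.+ t)))
  extendRow : ∀ k → k ≤ n →
    sumTo (n ∸ k) (λ t → F k (k ℕ.+ t)) + F k (suc n) ≡ sumTo (suc n ∸ k) (λ t → F k (k ℕ.+ t))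
  extendRow k k≤n = trans (cong (λ i → sumTo (n ∸ k) (λ t → F k (k ℕ.+ t)) + F k i) (sym (trans (ℕP.+-suc k (n ∸ k)) (cong suc (ℕP.m+[n∸m]≡n k≤n)))))
                          (cong (λ d → sumTo d (λ t → F k (k ℕ.+ t))) (sym (ℕP.+-∸-assoc 1 k≤n)))

sumTo-extend : ∀ b n {f : ℕ → ℤ} → b ≤ n → (∀ k → b < k → k ≤ n → f k ≡ 0ℤ) → sumTo b f ≡ sumTo n f
sumTo-extend b zero    z≤n _ = refl
sumTo-extend b (suc n) {f} b≤1+n f≗0 with b ℕP.≟ suc n
... | yes refl = refl
... | no b≢1+n =
  trans (sumTo-extend b n (ℕP.≤-pred b<1+n) (λ k b<k k≤n → f≗0 k b<k (ℕP.m≤n⇒m≤1+n k≤n)))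
        (trans (sym (ℤP.+-identityʳ _)) (cong (sumTo n f +_) (sym (f≗0 (suc n) b<1+n ℕP.≤-refl))))
  where b<1+n = ℕP.≤∧≢⇒< b≤1+n b≢1+n

sumTo-skip : ∀ a t (F : ℕ → ℤ) → (∀ r → r < t → F (suc (r ℕ.+ a)) ≡ 0ℤ) →
             sumTo (suc (t ℕ.+ a)) F ≡ sumTo a F + F (suc (t ℕ.+ a))
sumTo-skip a zero    F _   = refl
sumTo-skip a (suc t) F F≗0 =
  cong (_+ F (suc (suc t ℕ.+ a)))
       (trans (sumTo-skip a t F (λ r r<t → F≗0 r (ℕP.m<n⇒m<1+n r<t)))
              (trans (cong (sumTo a F +_) (F≗0 t ℕP.≤-refl)) (ℤP.+-identityʳ (sumTo a F))))

sumTo-multiples : ∀ d n (F : ℕ → ℤ) → (∀ k r → r < d → F (suc (r ℕ.+ suc d ℕ.* k)) ≡ 0ℤ) →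
                  sumTo (suc d ℕ.* n) F ≡ sumTo n (λ k → F (suc d ℕ.* k))
sumTo-multiples d zero    F _   = trans (cong (λ i → sumTo i F) (ℕP.*-zeroʳ d)) (cong F (sym (ℕP.*-zeroʳ (suc d))))
sumTo-multiples d (suc n) F F≗0 =
  trans (cong (λ i → sumTo i F) (ℕP.*-suc (suc d) n))
        (trans (sumTo-skip (suc d ℕ.* n) d F (F≗0 n))
               (cong₂ _+_ (sumTo-multiples d n F F≗0) (cong F (sym (ℕP.*-suc (suc d) n)))))

-- Power series in x and y

infix 4 _≐_
record _≐_ (A B : Series) : Set where
  constructor coeffwise
  field coeff : ∀ n m → A n m ≡ B n m
open _≐_

≐-setoid : Setoid _ _
≐-setoid = record
  { Carrier       = Series
  ; _≈_           = _≐_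
  ; isEquivalence = record
    { refl  = coeffwise (λ _ _ → refl)
    ; sym   = λ A≐B → coeffwise (λ n m → sym (coeff A≐B n m))
    ; trans = λ A≐B B≐C → coeffwise (λ n m → trans (coeff A≐B n m) (coeff B≐C n m))
    }
  }

open Setoid ≐-setoid using () renaming (refl to ≐-refl; sym to ≐-sym; trans to ≐-trans)

⊛-cong : ∀ {A A′ B B′} → A ≐ A′ → B ≐ B′ → A ⊛ B ≐ A′ ⊛ B′
⊛-cong A≐A′ B≐B′ = coeffwise λ n m →
  sumTo-cong n (λ i → sumTo-cong m (λ l → cong₂ _*_ (coeff A≐A′ i l) (coeff B≐B′ (n ∸ i) (m ∸ l))))

⊛-congˡ : ∀ {A A′} B → A ≐ A′ → A ⊛ B ≐ A′ ⊛ B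
⊛-congˡ B A≐A′ = ⊛-cong {B = B} A≐A′ ≐-refl

⊛-congʳ : ∀ A {B B′} → B ≐ B′ → A ⊛ B ≐ A ⊛ B′
⊛-congʳ A B≐B′ = ⊛-cong {A = A} ≐-refl B≐B′

⊛-comm : ∀ A B → A ⊛ B ≐ B ⊛ A
⊛-comm A B = coeffwise λ n m →
  let open ≡-Reasoning in
  begin
    sumTo n (λ i → sumTo m (λ l → A i l * B (n ∸ i) (m ∸ l)))
  ≡⟨ sumTo-reverse n _ ⟩
    sumTo n (λ i → sumTo m (λ l → A (n ∸ i) l * B (n ∸ (n ∸ i)) (m ∸ l)))
  ≡⟨ sumTo-cong n (λ i → sumTo-reverse m _) ⟩
    sumTo n (λ i → sumTo m (λ l → A (n ∸ i) (m ∸ l) * B (n ∸ (n ∸ i)) (m ∸ (m ∸ l))))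
  ≡⟨ sumTo-cong≤ n (λ i i≤n → sumTo-cong≤ m (λ l l≤m →
       trans (ℤP.*-comm (A (n ∸ i) (m ∸ l)) _)
             (cong₂ (λ a b → B a b * A (n ∸ i) (m ∸ l)) (ℕP.m∸[m∸n]≡n i≤n) (ℕP.m∸[m∸n]≡n l≤m)))) ⟩
    sumTo n (λ i → sumTo m (λ l → B i l * A (n ∸ i) (m ∸ l)))
  ∎

⊛-assoc : ∀ A B C → (A ⊛ B) ⊛ C ≐ A ⊛ (B ⊛ C)
⊛-assoc A B C = coeffwise assocAt
  where
  Term : ℕ → ℕ → ℕ → ℕ → ℕ → ℕ → ℤ
  Term n m i′ l′ i l = A i′ l′ * B (i ∸ i′) (l ∸ l′) * C (n ∸ i) (m ∸ l)

  reindex : ∀ n m i′ l′ t u →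
    Term n m i′ l′ (i′ ℕ.+ t) (l′ ℕ.+ u) ≡ A i′ l′ * (B t u * C (n ∸ i′ ∸ t) (m ∸ l′ ∸ u))
  reindex n m i′ l′ t u =
    trans (cong₂ (λ a b → A i′ l′ * B a b * C (n ∸ (i′ ℕ.+ t)) (m ∸ (l′ ℕ.+ u))) (ℕP.m+n∸m≡n i′ t) (ℕP.m+n∸m≡n l′ u))
    (trans (cong₂ (λ a b → A i′ l′ * B t u * C a b) (sym (ℕP.∸-+-assoc n i′ t)) (sym (ℕP.∸-+-assoc m l′ u)))
           (ℤP.*-assoc (A i′ l′) (B t u) _))

  assocAt : ∀ n m → ((A ⊛ B) ⊛ C) n m ≡ (A ⊛ (B ⊛ C)) n m
  assocAt n m =
    begin
      sumTo n (λ i → sumTo m (λ l → (A ⊛ B) i l * C (n ∸ i) (m ∸ l)))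
    ≡⟨ sumTo-cong n (λ i → sumTo-cong m (λ l →
         trans (sym (sumTo-*ʳ i _ _)) (sumTo-cong i (λ i′ → sym (sumTo-*ʳ l _ _))))) ⟩
      sumTo n (λ i → sumTo m (λ l → sumTo i (λ i′ → sumTo l (λ l′ → Term n m i′ l′ i l))))
    ≡⟨ sumTo-cong n (λ i → sumTo-swap m i _) ⟩
      sumTo n (λ i → sumTo i (λ i′ → sumTo m (λ l → sumTo l (λ l′ → Term n m i′ l′ i l))))
    ≡⟨ sumTo-triangle n _ ⟩
      sumTo n (λ i′ → sumTo (n ∸ i′) (λ t → sumTo m (λ l → sumTo l (λ l′ → Term n m i′ l′ (i′ ℕ.+ t) l))))
    ≡⟨ sumTo-cong n (λ i′ → sumTo-cong (n ∸ i′) (λ t → sumTo-triangle m _)) ⟩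
      sumTo n (λ i′ → sumTo (n ∸ i′) (λ t → sumTo m (λ l′ → sumTo (m ∸ l′) (λ u →
        Term n m i′ l′ (i′ ℕ.+ t) (l′ ℕ.+ u)))))
    ≡⟨ sumTo-cong n (λ i′ → sumTo-swap (n ∸ i′) m _) ⟩
      sumTo n (λ i′ → sumTo m (λ l′ → sumTo (n ∸ i′) (λ t → sumTo (m ∸ l′) (λ u →
        Term n m i′ l′ (i′ ℕ.+ t) (l′ ℕ.+ u)))))
    ≡⟨ sumTo-cong n (λ i′ → sumTo-cong m (λ l′ → sumTo-cong (n ∸ i′) (λ t → sumTo-cong (m ∸ l′) (λ u →
         reindex n m i′ l′ t u)))) ⟩
      sumTo n (λ i′ → sumTo m (λ l′ → sumTo (n ∸ i′) (λ t → sumTo (m ∸ l′) (λ u →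
        A i′ l′ * (B t u * C (n ∸ i′ ∸ t) (m ∸ l′ ∸ u))))))
    ≡⟨ sumTo-cong n (λ i′ → sumTo-cong m (λ l′ →
         trans (sumTo-cong (n ∸ i′) (λ t → sumTo-*ˡ (m ∸ l′) (A i′ l′) _)) (sumTo-*ˡ (n ∸ i′) (A i′ l′) _))) ⟩
      sumTo n (λ i′ → sumTo m (λ l′ → A i′ l′ * (B ⊛ C) (n ∸ i′) (m ∸ l′)))
    ∎
    where open ≡-Reasoning

⊛-leftComm : ∀ A B C → A ⊛ (B ⊛ C) ≐ B ⊛ (A ⊛ C)
⊛-leftComm A B C =
  begin
    A ⊛ (B ⊛ C)  ≈⟨ ≐-sym (⊛-assoc A B C) ⟩
    (A ⊛ B) ⊛ C  ≈⟨ ⊛-congˡ C (⊛-comm A B) ⟩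
    (B ⊛ A) ⊛ C  ≈⟨ ⊛-assoc B A C ⟩
    B ⊛ (A ⊛ C)  ∎
  where open import Relation.Binary.Reasoning.Setoid ≐-setoid

_+ₛ_ : Series → Series → Series
(A +ₛ B) n m = A n m + B n m

-ₛ_ : Series → Series
(-ₛ A) n m = - A n m

⊛-distribʳ-+ₛ : ∀ A B C → (A +ₛ B) ⊛ C ≐ (A ⊛ C) +ₛ (B ⊛ C)
⊛-distribʳ-+ₛ A B C = coeffwise λ n m →
  trans (sumTo-cong n (λ i →
           trans (sumTo-cong m (λ l → ℤP.*-distribʳ-+ (C (n ∸ i) (m ∸ l)) (A i l) (B i l)))
                 (sumTo-+ m (λ l → A i l * C (n ∸ i) (m ∸ l)) (λ l → B i l * C (n ∸ i) (m ∸ l)))))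
        (sumTo-+ n _ _)

⊛-negˡ : ∀ A C → (-ₛ A) ⊛ C ≐ -ₛ (A ⊛ C)
⊛-negˡ A C = coeffwise λ n m →
  trans (sumTo-cong n (λ i →
           trans (sumTo-cong m (λ l → sym (ℤP.neg-distribˡ-* (A i l) (C (n ∸ i) (m ∸ l)))))
                 (sumTo-neg m (λ l → A i l * C (n ∸ i) (m ∸ l)))))
        (sumTo-neg n _)

⊛-identityˡ : ∀ A → oneS ⊛ A ≐ A
⊛-identityˡ A = coeffwise λ n m →
  trans (sumTo-only₀ n (λ i _ → sumTo-zero m (λ l _ → ℤP.*-zeroˡ (A (n ∸ suc i) (m ∸ l)))))
        (trans (sumTo-only₀ m (λ l _ → ℤP.*-zeroˡ (A n (m ∸ suc l)))) (ℤP.*-identityˡ (A n m)))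

x⊛-zero : ∀ A m → (xS ⊛ A) 0 m ≡ 0ℤ
x⊛-zero A m = sumTo-zero m (λ l _ → ℤP.*-zeroˡ (A 0 (m ∸ l)))

x⊛-suc : ∀ A n m → (xS ⊛ A) (suc n) m ≡ A n m
x⊛-suc A n m =
  trans (sumTo-only₁ n (x⊛-zero (λ i → A (suc i)) m)
                       (λ i _ → sumTo-zero m (λ l _ → ℤP.*-zeroˡ (A (n ∸ suc i) (m ∸ l)))))
        (trans (sumTo-only₀ m (λ l _ → ℤP.*-zeroˡ (A n (m ∸ suc l)))) (ℤP.*-identityˡ (A n m)))

xyS : Series
xyS 1 1 = 1ℤ
xyS _ _ = 0ℤ

xy⊛-zero : ∀ A m → (xyS ⊛ A) 0 m ≡ 0ℤ
xy⊛-zero A m = sumTo-zero m (λ l _ → ℤP.*-zeroˡ (A 0 (m ∸ l)))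

xy⊛-suc-zero : ∀ A n → (xyS ⊛ A) (suc n) 0 ≡ 0ℤ
xy⊛-suc-zero A n = sumTo-zero (suc n) λ
  { zero          _ → ℤP.*-zeroˡ (A (suc n) 0)
  ; (suc zero)    _ → ℤP.*-zeroˡ (A n 0)
  ; (suc (suc i)) _ → ℤP.*-zeroˡ (A (n ∸ suc i) 0)
  }

xy⊛-suc-suc : ∀ A n m → (xyS ⊛ A) (suc n) (suc m) ≡ A n m
xy⊛-suc-suc A n m =
  trans (sumTo-only₁ n (sumTo-zero (suc m) (λ l _ → ℤP.*-zeroˡ (A (suc n) (suc m ∸ l))))
                       (λ i _ → sumTo-zero (suc m) (λ l _ → ℤP.*-zeroˡ (A (n ∸ suc i) (suc m ∸ l)))))
        (trans (sumTo-only₁ m (ℤP.*-zeroˡ (A n (suc m))) (λ l _ → ℤP.*-zeroˡ (A n (m ∸ suc l))))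
               (ℤP.*-identityˡ (A n m)))

-- The series W = (1 - x)/(1 - xy) and the run transform

one-minus-⊛ : ∀ U T n m → ((oneS +ₛ (-ₛ U)) ⊛ T) n m ≡ T n m - (U ⊛ T) n m
one-minus-⊛ U T n m =
  trans (coeff (⊛-distribʳ-+ₛ oneS (-ₛ U) T) n m)
        (cong₂ _+_ (coeff (⊛-identityˡ T) n m) (coeff (⊛-negˡ U T) n m))

oneMinusX≐ : oneMinusX ≐ oneS +ₛ (-ₛ xS)
oneMinusX≐ = coeffwise λ
  { zero          zero    → refl
  ; zero          (suc m) → refl
  ; (suc zero)    zero    → refl
  ; (suc zero)    (suc m) → refl
  ; (suc (suc n)) zero    → refl
  ; (suc (suc n)) (suc m) → refl
  }

oneMinusXY : Series
oneMinusXY = oneS +ₛ (-ₛ xyS)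

oneMinusXY-inverse : oneMinusXY ⊛ invOneMinusXY ≐ oneS
oneMinusXY-inverse = coeffwise inverseAt
  where
  inverseAt : ∀ n m → (oneMinusXY ⊛ invOneMinusXY) n m ≡ oneS n m
  inverseAt zero    zero    = trans (one-minus-⊛ xyS invOneMinusXY 0 0) (cong (λ z → 1ℤ - z) (xy⊛-zero invOneMinusXY 0))
  inverseAt zero    (suc m) = trans (one-minus-⊛ xyS invOneMinusXY 0 (suc m)) (cong (λ z → 0ℤ - z) (xy⊛-zero invOneMinusXY (suc m)))
  inverseAt (suc n) zero    = trans (one-minus-⊛ xyS invOneMinusXY (suc n) 0) (cong (λ z → 0ℤ - z) (xy⊛-suc-zero invOneMinusXY n))
  inverseAt (suc n) (suc m) = trans (one-minus-⊛ xyS invOneMinusXY (suc n) (suc m))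
                                    (trans (cong (λ z → invOneMinusXY (suc n) (suc m) - z) (xy⊛-suc-suc invOneMinusXY n m))
                                           (ℤP.+-inverseʳ (invOneMinusXY n m)))

W : Series
W = oneMinusX ⊛ invOneMinusXY

oneMinusXY⊛W⊛ : ∀ S → oneMinusXY ⊛ (W ⊛ S) ≐ oneMinusX ⊛ S
oneMinusXY⊛W⊛ S =
  begin
    oneMinusXY ⊛ (W ⊛ S)                            ≈⟨ ⊛-leftComm oneMinusXY W S ⟩
    W ⊛ (oneMinusXY ⊛ S)                            ≈⟨ ⊛-assoc oneMinusX invOneMinusXY (oneMinusXY ⊛ S) ⟩
    oneMinusX ⊛ (invOneMinusXY ⊛ (oneMinusXY ⊛ S))  ≈⟨ ⊛-congʳ oneMinusX (≐-sym (⊛-assoc invOneMinusXY oneMinusXY S)) ⟩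
    oneMinusX ⊛ ((invOneMinusXY ⊛ oneMinusXY) ⊛ S)  ≈⟨ ⊛-congʳ oneMinusX (⊛-congˡ S (≐-trans (⊛-comm invOneMinusXY oneMinusXY) oneMinusXY-inverse)) ⟩
    oneMinusX ⊛ (oneS ⊛ S)                          ≈⟨ ⊛-congʳ oneMinusX (⊛-identityˡ S) ⟩
    oneMinusX ⊛ S                                   ∎
  where open import Relation.Binary.Reasoning.Setoid ≐-setoid

W⊛-balance : ∀ S n m → (W ⊛ S) n m - (xyS ⊛ (W ⊛ S)) n m ≡ S n m - (xS ⊛ S) n m
W⊛-balance S n m =
  trans (sym (one-minus-⊛ xyS (W ⊛ S) n m))
  (trans (coeff (oneMinusXY⊛W⊛ S) n m)
  (trans (coeff (⊛-congˡ S oneMinusX≐) n m) (one-minus-⊛ xS S n m)))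

private
  solve-for : ∀ {a t r} → a - t ≡ r → a ≡ r + t
  solve-for {a} {t} refl = minus-plus a t
    where
    minus-plus : ∀ a t → a ≡ a - t + t
    minus-plus = solve-∀

W⊛-zero : ∀ S m → (W ⊛ S) 0 m ≡ S 0 m
W⊛-zero S m =
  trans (solve-for (W⊛-balance S 0 m))
        (trans (cong₂ (λ u v → S 0 m - u + v) (x⊛-zero S m) (xy⊛-zero (W ⊛ S) m))
               (trans (ℤP.+-identityʳ _) (ℤP.+-identityʳ _)))

W⊛-suc-zero : ∀ S a → (W ⊛ S) (suc a) 0 ≡ S (suc a) 0 - S a 0
W⊛-suc-zero S a =
  trans (solve-for (W⊛-balance S (suc a) 0))
        (trans (cong₂ (λ u v → S (suc a) 0 - u + v) (x⊛-suc S a 0) (xy⊛-suc-zero (W ⊛ S) a))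
               (ℤP.+-identityʳ _))

W⊛-suc-suc : ∀ S a m → (W ⊛ S) (suc a) (suc m) ≡ S (suc a) (suc m) - S a (suc m) + (W ⊛ S) a m
W⊛-suc-suc S a m =
  trans (solve-for (W⊛-balance S (suc a) (suc m)))
        (cong₂ (λ u v → S (suc a) (suc m) - u + v) (x⊛-suc S a (suc m)) (xy⊛-suc-suc (W ⊛ S) a m))

⊛-interchange : ∀ A B C D → (A ⊛ B) ⊛ (C ⊛ D) ≐ (A ⊛ C) ⊛ (B ⊛ D)
⊛-interchange A B C D =
  begin
    (A ⊛ B) ⊛ (C ⊛ D)  ≈⟨ ⊛-assoc A B (C ⊛ D) ⟩
    A ⊛ (B ⊛ (C ⊛ D))  ≈⟨ ⊛-congʳ A (⊛-leftComm B C D) ⟩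
    A ⊛ (C ⊛ (B ⊛ D))  ≈⟨ ≐-sym (⊛-assoc A C (B ⊛ D)) ⟩
    (A ⊛ C) ⊛ (B ⊛ D)  ∎
  where open import Relation.Binary.Reasoning.Setoid ≐-setoid

powS-cong : ∀ {A B} k → A ≐ B → powS A k ≐ powS B k
powS-cong zero    A≐B = ≐-refl
powS-cong (suc k) A≐B = ⊛-cong A≐B (powS-cong k A≐B)

powS-⊛ : ∀ A B k → powS (A ⊛ B) k ≐ powS A k ⊛ powS B k
powS-⊛ A B zero    = ≐-sym (⊛-identityˡ oneS)
powS-⊛ A B (suc k) = ≐-trans (⊛-congʳ (A ⊛ B) (powS-⊛ A B k)) (⊛-interchange A B (powS A k) (powS B k))

xpow⊛-< : ∀ k T {n} m → n < k → (powS xS k ⊛ T) n m ≡ 0ℤ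
xpow⊛-< (suc k) T {zero}  m _ = trans (coeff (⊛-assoc xS (powS xS k) T) 0 m) (x⊛-zero (powS xS k ⊛ T) m)
xpow⊛-< (suc k) T {suc n} m (s≤s n<k) =
  trans (coeff (⊛-assoc xS (powS xS k) T) (suc n) m) (trans (x⊛-suc (powS xS k ⊛ T) n m) (xpow⊛-< k T m n<k))

xpow⊛-≥ : ∀ k T {n} m → k ≤ n → (powS xS k ⊛ T) n m ≡ T (n ∸ k) m
xpow⊛-≥ zero    T {n} m _ = coeff (⊛-identityˡ T) n m
xpow⊛-≥ (suc k) T {suc n} m (s≤s k≤n) =
  trans (coeff (⊛-assoc xS (powS xS k) T) (suc n) m) (trans (x⊛-suc (powS xS k ⊛ T) n m) (xpow⊛-≥ k T m k≤n))

runArg≐ : runArg ≐ xS ⊛ W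
runArg≐ = ⊛-assoc xS oneMinusX invOneMinusXY

runArg-pow : ∀ k → powS runArg k ≐ powS xS k ⊛ powS W k
runArg-pow k = ≐-trans (powS-cong k runArg≐) (powS-⊛ xS W k)

runArg-pow-< : ∀ k {n} m → n < k → powS runArg k n m ≡ 0ℤ
runArg-pow-< k {n} m n<k = trans (coeff (runArg-pow k) n m) (xpow⊛-< k (powS W k) m n<k)

W⊛runArg-pow : ∀ k {n} m → k ≤ n → (W ⊛ powS runArg k) n m ≡ powS W (suc k) (n ∸ k) m
W⊛runArg-pow k {n} m k≤n =
  trans (coeff (⊛-congʳ W (runArg-pow k)) n m)
        (trans (coeff (⊛-leftComm W (powS xS k) (powS W k)) n m) (xpow⊛-≥ k (powS W (suc k)) m k≤n))

Φ-coeff : ∀ f n m → Φ f n m ≡ sumTo n (λ k → f k * powS W (suc k) (n ∸ k) m)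
Φ-coeff f n m =
  begin
    sumTo n (λ i → sumTo m (λ l → W i l * sumTo (n ∸ i) (λ k → f k * R k (n ∸ i) (m ∸ l))))
  ≡⟨ sumTo-cong≤ n (λ i _ → sumTo-cong m (λ l → cong (W i l *_)
       (sumTo-extend (n ∸ i) n (ℕP.m∸n≤m n i) (λ k i<k _ →
          trans (cong (f k *_) (runArg-pow-< k (m ∸ l) i<k)) (ℤP.*-zeroʳ (f k)))))) ⟩
    sumTo n (λ i → sumTo m (λ l → W i l * sumTo n (λ k → f k * R k (n ∸ i) (m ∸ l))))
  ≡⟨ sumTo-cong n (λ i → sumTo-cong m (λ l → sym (sumTo-*ˡ n (W i l) _))) ⟩
    sumTo n (λ i → sumTo m (λ l → sumTo n (λ k → W i l * (f k * R k (n ∸ i) (m ∸ l)))))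
  ≡⟨ trans (sumTo-cong n (λ i → sumTo-swap m n _)) (sumTo-swap n n _) ⟩
    sumTo n (λ k → sumTo n (λ i → sumTo m (λ l → W i l * (f k * R k (n ∸ i) (m ∸ l)))))
  ≡⟨ sumTo-cong n (λ k → trans (sumTo-cong n (λ i → trans (sumTo-cong m (λ l → leftComm (W i l) (f k) _))
                                                           (sumTo-*ˡ m (f k) _)))
                               (sumTo-*ˡ n (f k) _)) ⟩
    sumTo n (λ k → f k * (W ⊛ R k) n m)
  ≡⟨ sumTo-cong≤ n (λ k k≤n → cong (f k *_) (W⊛runArg-pow k m k≤n)) ⟩
    sumTo n (λ k → f k * powS W (suc k) (n ∸ k) m)
  ∎
  where
  open ≡-Reasoning
  R : ℕ → Series
  R = powS runArg
  leftComm : ∀ a b c → a * (b * c) ≡ b * (a * c)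
  leftComm = solve-∀

-- Sums over paths, and sequences in the path length

sumOver : List Path → (Path → ℤ) → ℤ
sumOver []       f = 0ℤ
sumOver (p ∷ ps) f = f p + sumOver ps f

sumOver-++ : ∀ ps qs f → sumOver (ps ++ qs) f ≡ sumOver ps f + sumOver qs f
sumOver-++ []       qs f = sym (ℤP.+-identityˡ _)
sumOver-++ (p ∷ ps) qs f = trans (cong (f p +_) (sumOver-++ ps qs f)) (sym (ℤP.+-assoc (f p) _ _))

sumOver-map : ∀ ps (g : Path → Path) f → sumOver (map g ps) f ≡ sumOver ps (f ∘ g)
sumOver-map []       g f = refl
sumOver-map (p ∷ ps) g f = cong (f (g p) +_) (sumOver-map ps g f)

sumOver-cong : ∀ ps {f g : Path → ℤ} → (∀ p → f p ≡ g p) → sumOver ps f ≡ sumOver ps g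
sumOver-cong []       _   = refl
sumOver-cong (p ∷ ps) f≗g = cong₂ _+_ (f≗g p) (sumOver-cong ps f≗g)

sumOver-zero : ∀ ps {f : Path → ℤ} → (∀ p → f p ≡ 0ℤ) → sumOver ps f ≡ 0ℤ
sumOver-zero []       _   = refl
sumOver-zero (p ∷ ps) f≗0 = cong₂ _+_ (f≗0 p) (sumOver-zero ps f≗0)

sumOver-+ : ∀ ps (f g : Path → ℤ) → sumOver ps (λ p → f p + g p) ≡ sumOver ps f + sumOver ps g
sumOver-+ []       f g = refl
sumOver-+ (p ∷ ps) f g = trans (cong (f p + g p +_) (sumOver-+ ps f g)) (interchange (f p) (g p) _ _)
  where
  interchange : ∀ a b c d → a + b + (c + d) ≡ a + c + (b + d)
  interchange = solve-∀

sumOver-neg : ∀ ps (f : Path → ℤ) → sumOver ps (λ p → - f p) ≡ - sumOver ps f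
sumOver-neg []       f = refl
sumOver-neg (p ∷ ps) f = trans (cong (- f p +_) (sumOver-neg ps f)) (sym (ℤP.neg-distrib-+ (f p) _))

sumOver-*ʳ : ∀ ps (f : Path → ℤ) c → sumOver ps (λ p → f p * c) ≡ sumOver ps f * c
sumOver-*ʳ []       f c = sym (ℤP.*-zeroˡ c)
sumOver-*ʳ (p ∷ ps) f c =
  trans (cong (f p * c +_) (sumOver-*ʳ ps f c)) (sym (ℤP.*-distribʳ-+ c (f p) (sumOver ps f)))

sumPaths : ℕ → (Path → ℤ) → ℤ
sumPaths L = sumOver (allPaths L)

sumPaths-zero : ∀ f → sumPaths 0 f ≡ f []
sumPaths-zero f = ℤP.+-identityʳ (f [])

sumPaths-suc : ∀ L f → sumPaths (suc L) f ≡ sumPaths L (f ∘ (true ∷_)) + sumPaths L (f ∘ (false ∷_))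
sumPaths-suc L f =
  trans (sumOver-++ (map (true ∷_) (allPaths L)) _ f)
        (cong₂ _+_ (sumOver-map (allPaths L) (true ∷_) f) (sumOver-map (allPaths L) (false ∷_) f))

sumPaths-cong : ∀ L {f g : Path → ℤ} → (∀ p → length p ≡ L → f p ≡ g p) → sumPaths L f ≡ sumPaths L g
sumPaths-cong zero    f≗g = cong (_+ 0ℤ) (f≗g [] refl)
sumPaths-cong (suc L) {f} {g} f≗g =
  trans (sumPaths-suc L f)
        (trans (cong₂ _+_ (sumPaths-cong L (λ p ∣p∣≡L → f≗g (true ∷ p) (cong suc ∣p∣≡L)))
                          (sumPaths-cong L (λ p ∣p∣≡L → f≗g (false ∷ p) (cong suc ∣p∣≡L))))
               (sym (sumPaths-suc L g)))

𝟙 : Bool → ℤ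
𝟙 true  = 1ℤ
𝟙 false = 0ℤ

count : ℕ → (Path → Bool) → ℤ
count L P = sumPaths L (𝟙 ∘ P)

count-cong : ∀ L {P Q : Path → Bool} → (∀ p → P p ≡ Q p) → count L P ≡ count L Q
count-cong L P≗Q = sumOver-cong (allPaths L) (cong 𝟙 ∘ P≗Q)

count-suc : ∀ L P → count (suc L) P ≡ count L (P ∘ (true ∷_)) + count L (P ∘ (false ∷_))
count-suc L P = sumPaths-suc L (𝟙 ∘ P)

count-none : ∀ L → count L (λ _ → false) ≡ 0ℤ
count-none L = sumOver-zero (allPaths L) (λ _ → refl)

count-zero : ∀ P → P [] ≡ false → count 0 P ≡ 0ℤ
count-zero P P[]≡false = trans (sumPaths-zero (𝟙 ∘ P)) (cong 𝟙 P[]≡false)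

count-partition : ∀ L (P Q : Path → Bool) → count L P ≡ count L (λ p → P p ∧ Q p) + count L (λ p → P p ∧ not (Q p))
count-partition L P Q =
  trans (sumOver-cong (allPaths L) (λ p → 𝟙-partition (P p) (Q p)))
        (sumOver-+ (allPaths L) (λ p → 𝟙 (P p ∧ Q p)) (λ p → 𝟙 (P p ∧ not (Q p))))
  where
  𝟙-partition : ∀ a b → 𝟙 a ≡ 𝟙 (a ∧ b) + 𝟙 (a ∧ not b)
  𝟙-partition true  true  = refl
  𝟙-partition true  false = refl
  𝟙-partition false b     = refl

length-filterB : ∀ (P : Path → Bool) ps → ℤ.+ length (filterB P ps) ≡ sumOver ps (𝟙 ∘ P)
length-filterB P []       = refl
length-filterB P (p ∷ ps) with P p
... | true  = trans (ℤP.pos-+ 1 (length (filterB P ps))) (cong (1ℤ +_) (length-filterB P ps))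
... | false = trans (length-filterB P ps) (sym (ℤP.+-identityˡ _))

-- Multiplication by z^d of a sequence F written as Σ_L F L z^L.
delay : ℕ → (ℕ → ℤ) → ℕ → ℤ
delay zero    F L       = F L
delay (suc d) F zero    = 0ℤ
delay (suc d) F (suc L) = delay d F L

delay-+ : ∀ d F L → delay d F (d ℕ.+ L) ≡ F L
delay-+ zero    F L = refl
delay-+ (suc d) F L = delay-+ d F L

delay-< : ∀ d F {L} → L < d → delay d F L ≡ 0ℤ
delay-< (suc d) F {zero}  _         = refl
delay-< (suc d) F {suc L} (s≤s L<d) = delay-< d F L<d

delay-shift : ∀ d t F L → delay (d ℕ.+ t) F (t ℕ.+ L) ≡ delay d F L
delay-shift d zero    F L = cong (λ e → delay e F L) (ℕP.+-identityʳ d)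
delay-shift d (suc t) F L = trans (cong (λ e → delay e F (suc (t ℕ.+ L))) (ℕP.+-suc d t)) (delay-shift d t F L)

delay-sumTo : ∀ d (K : ℕ → ℕ → ℤ) L →
  sumTo L (λ L′ → delay d (K L′) (L ∸ L′)) ≡ delay d (λ L → sumTo L (λ L′ → K L′ (L ∸ L′))) L
delay-sumTo zero    K L       = refl
delay-sumTo (suc d) K zero    = refl
delay-sumTo (suc d) K (suc L) =
  trans (cong₂ _+_ (sumTo-cong≤ L (λ L′ L′≤L → cong (delay (suc d) (K L′)) (ℕP.+-∸-assoc 1 L′≤L)))
                   (cong (delay (suc d) (K (suc L))) (ℕP.n∸n≡0 L)))
        (trans (ℤP.+-identityʳ _) (delay-sumTo d K L))

delay-cong : ∀ d L {F G : ℕ → ℤ} → (∀ L′ → d ℕ.+ L′ ≡ L → F L′ ≡ G L′) → delay d F L ≡ delay d G L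
delay-cong zero    L       F≗G = F≗G L refl
delay-cong (suc d) zero    F≗G = refl
delay-cong (suc d) (suc L) F≗G = delay-cong d L (λ L′ eq → F≗G L′ (cong suc eq))

delay-zero : ∀ d L → delay d (λ _ → 0ℤ) L ≡ 0ℤ
delay-zero zero    L       = refl
delay-zero (suc d) zero    = refl
delay-zero (suc d) (suc L) = delay-zero d L

delay-if : ∀ b d F L → (if b then delay d F L else 0ℤ) ≡ delay d (λ L → if b then F L else 0ℤ) L
delay-if b     zero    F L       = refl
delay-if true  (suc d) F zero    = refl
delay-if false (suc d) F zero    = refl
delay-if b     (suc d) F (suc L) = delay-if b d F L

-- Only Σ (λ _ → 0) ≡ 0 is needed: delay d reduces definitionally under the binder.
delay-linear : ∀ {X : Set} (Σ : (X → ℤ) → ℤ) → Σ (λ _ → 0ℤ) ≡ 0ℤ →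
               ∀ d (F : X → ℕ → ℤ) L → Σ (λ x → delay d (F x) L) ≡ delay d (λ L → Σ (λ x → F x L)) L
delay-linear Σ Σ0≡0 zero    F L       = refl
delay-linear Σ Σ0≡0 (suc d) F zero    = Σ0≡0
delay-linear Σ Σ0≡0 (suc d) F (suc L) = delay-linear Σ Σ0≡0 d F L

<-or-+ : ∀ d {P : ℕ → Set} → (∀ {i} → i < d → P i) → (∀ i → P (d ℕ.+ i)) → ∀ i → P i
<-or-+ d {P} below above i with ℕP.<-≤-connex i d
... | inj₁ i<d = below i<d
... | inj₂ d≤i = subst P (ℕP.m+[n∸m]≡n d≤i) (above (i ∸ d))

-- An automaton for j-Dyck paths

module JDyck (j′ : ℕ) where

  j : ℕ
  j = suc j′

  multiple : ℕ → Bool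
  multiple x = x % j ≡ᵇ 0

  -- accepts h c p: p leads from height h to 0 without going below, and every ascent has length
  -- divisible by j, given that the ascent under way has length c so far.
  accepts : ℕ → ℕ → Path → Bool
  accepts h       c []          = (h ≡ᵇ 0) ∧ multiple c
  accepts h       c (true ∷ p)  = accepts (suc h) (suc c) p
  accepts zero    c (false ∷ p) = false
  accepts (suc h) c (false ∷ p) = multiple c ∧ accepts h 0 p

  leadingUps : Path → ℕ
  leadingUps (true ∷ p) = suc (leadingUps p)
  leadingUps _          = 0

  dropUps : Path → Path
  dropUps (true ∷ p) = dropUps p
  dropUps p          = p

  descendsAtLeast : ℕ → Path → Bool
  descendsAtLeast zero    p           = true
  descendsAtLeast (suc k) (false ∷ p) = descendsAtLeast k p
  descendsAtLeast (suc k) _           = false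

  startsWithPyramid : Path → Bool
  startsWithPyramid (true ∷ p) = descendsAtLeast (suc (leadingUps p)) (dropUps p)
  startsWithPyramid _          = false

  -- valley: the previous step, if any, was a down-step. A j-nice pyramid ascent starts at such a
  -- point at a height divisible by j, since its length is divisible by j.
  niceStart : ℕ → Bool → Bool
  niceStart h valley = valley ∧ multiple h

  nicePyramids : ℕ → Bool → Path → ℕ
  nicePyramids h valley []          = 0
  nicePyramids h valley (true ∷ p)  =
    (if niceStart h valley ∧ startsWithPyramid (true ∷ p) then 1 else 0) ℕ.+ nicePyramids (suc h) false p
  nicePyramids h valley (false ∷ p) = nicePyramids (ℕ.pred h) true p

  landings : ℕ → Path → ℕ
  landings h       []          = 0
  landings h       (true ∷ p)  = landings (suc h) p
  landings zero    (false ∷ p) = landings zero p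
  landings (suc h) (false ∷ p) = (if multiple h then 1 else 0) ℕ.+ landings h p

  slots : ℕ → Bool → Path → ℕ
  slots h valley p = (if niceStart h valley then 1 else 0) ℕ.+ landings h p

  multiple-j : multiple j ≡ true
  multiple-j = cong (_≡ᵇ 0) (ℕDM.n%n≡0 j)

  multiple-< : ∀ {a} → 0 < a → a < j → multiple a ≡ false
  multiple-< {suc a} _ a<j = cong (_≡ᵇ 0) (ℕDM.m<n⇒m%n≡m a<j)

  multiple-+j : ∀ a → multiple (a ℕ.+ j) ≡ multiple a
  multiple-+j a = cong (_≡ᵇ 0) (ℕDM.[m+n]%n≡m%n a j)

  ≡ᵇ⇒≡ : ∀ {a b} → (a ≡ᵇ b) ≡ true → a ≡ b
  ≡ᵇ⇒≡ {a} {b} a≡ᵇb = ℕP.≡ᵇ⇒≡ a b (subst T (sym a≡ᵇb) _)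

  multiple⇒≡*j : ∀ {c} → multiple c ≡ true → c ≡ (c / j) ℕ.* j
  multiple⇒≡*j {c} mc = trans (ℕDM.m≡m%n+[m/n]*n c j) (cong (ℕ._+ (c / j) ℕ.* j) (≡ᵇ⇒≡ mc))

  multiple-+ : ∀ h {c} → multiple c ≡ true → multiple (h ℕ.+ c) ≡ multiple h
  multiple-+ h {c} mc =
    cong (_≡ᵇ 0) (trans (cong (λ z → (h ℕ.+ z) % j) (multiple⇒≡*j mc)) (ℕDM.[m+kn]%n≡m%n h (c / j) j))

  ascentsOK : ℕ → Path → Bool
  ascentsOK c []          = multiple c
  ascentsOK c (true ∷ p)  = ascentsOK (suc c) p
  ascentsOK c (false ∷ p) = multiple c ∧ ascentsOK 0 p

  accepts≡dyck∧ascentsOK : ∀ h c p → accepts h c p ≡ dyckFrom h p ∧ ascentsOK c p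
  accepts≡dyck∧ascentsOK h       c []          = refl
  accepts≡dyck∧ascentsOK h       c (true ∷ p)  = accepts≡dyck∧ascentsOK (suc h) (suc c) p
  accepts≡dyck∧ascentsOK zero    c (false ∷ p) = refl
  accepts≡dyck∧ascentsOK (suc h) c (false ∷ p) =
    trans (cong (multiple c ∧_) (accepts≡dyck∧ascentsOK h 0 p)) (∧-leftComm (multiple c) (dyckFrom h p) _)
    where
    ∧-leftComm : ∀ a b c → a ∧ (b ∧ c) ≡ b ∧ (a ∧ c)
    ∧-leftComm true  b     c = refl
    ∧-leftComm false true  c = refl
    ∧-leftComm false false c = refl

  consRun : Bool × ℕ → List (Bool × ℕ) → List (Bool × ℕ)
  consRun (b , k) []             = (b , k) ∷ []
  consRun (b , k) ((c , l) ∷ rs) = if sameStep b c then (c , k ℕ.+ l) ∷ rs else (b , k) ∷ (c , l) ∷ rs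

  runs-∷ : ∀ b p → runs (b ∷ p) ≡ consRun (b , 1) (runs p)
  runs-∷ b p with runs p
  ... | []           = refl
  ... | (c , k) ∷ rs = refl

  consRun-up-up : ∀ k rs → consRun (true , k) (consRun (true , 1) rs) ≡ consRun (true , suc k) rs
  consRun-up-up k []                = cong (λ k′ → (true , k′) ∷ []) (ℕP.+-comm k 1)
  consRun-up-up k ((true , l) ∷ r)  = cong (λ k′ → (true , k′) ∷ r) (ℕP.+-suc k l)
  consRun-up-up k ((false , l) ∷ r) = cong (λ k′ → (true , k′) ∷ (false , l) ∷ r) (ℕP.+-comm k 1)

  private
    AD : List (Bool × ℕ) → Bool
    AD = ascentsDivisible j

  AD-consRun-down : ∀ k rs → AD (consRun (false , k) rs) ≡ AD rs
  AD-consRun-down k []                = refl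
  AD-consRun-down k ((false , l) ∷ r) = refl
  AD-consRun-down k ((true , l) ∷ r)  = refl

  AD-consRun-up-down : ∀ k rs → AD (consRun (true , k) (consRun (false , 1) rs)) ≡ multiple k ∧ AD rs
  AD-consRun-up-down k []                = refl
  AD-consRun-up-down k ((false , l) ∷ r) = refl
  AD-consRun-up-down k ((true , l) ∷ r)  = refl

  AD-runs : ∀ p → AD (runs p) ≡ ascentsOK 0 p
  AD-consRun-up : ∀ p k → AD (consRun (true , k) (runs p)) ≡ ascentsOK k p

  AD-runs []          = refl
  AD-runs (true ∷ p)  = trans (cong AD (runs-∷ true p)) (AD-consRun-up p 1)
  AD-runs (false ∷ p) = trans (cong AD (runs-∷ false p)) (trans (AD-consRun-down 1 (runs p)) (AD-runs p))

  AD-consRun-up []          k = BoolP.∧-identityʳ (multiple k)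
  AD-consRun-up (true ∷ p)  k =
    trans (cong (λ rs → AD (consRun (true , k) rs)) (runs-∷ true p))
          (trans (cong AD (consRun-up-up k (runs p))) (AD-consRun-up p (suc k)))
  AD-consRun-up (false ∷ p) k =
    trans (cong (λ rs → AD (consRun (true , k) rs)) (runs-∷ false p))
          (trans (AD-consRun-up-down k (runs p)) (cong (multiple k ∧_) (AD-runs p)))

  isJDyck≡accepts : ∀ p → isJDyck j p ≡ accepts 0 0 p
  isJDyck≡accepts p = trans (cong (dyckFrom 0 p ∧_) (AD-runs p)) (sym (accepts≡dyck∧ascentsOK 0 0 p))

  numUp : Path → ℕ
  numUp []          = 0
  numUp (true ∷ p)  = suc (numUp p)
  numUp (false ∷ p) = numUp p

  length≡numUp+numDown : ∀ p → length p ≡ numUp p ℕ.+ numDown p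
  length≡numUp+numDown []          = refl
  length≡numUp+numDown (true ∷ p)  = cong suc (length≡numUp+numDown p)
  length≡numUp+numDown (false ∷ p) = trans (cong suc (length≡numUp+numDown p)) (sym (ℕP.+-suc (numUp p) (numDown p)))

  accepts⇒+numUp≡numDown : ∀ h c p → accepts h c p ≡ true → h ℕ.+ numUp p ≡ numDown p
  accepts⇒+numUp≡numDown h       c []          acc = trans (ℕP.+-identityʳ h) (≡ᵇ⇒≡ (BoolP.∧-conicalˡ _ _ acc))
  accepts⇒+numUp≡numDown h       c (true ∷ p)  acc = trans (ℕP.+-suc h (numUp p)) (accepts⇒+numUp≡numDown (suc h) (suc c) p acc)
  accepts⇒+numUp≡numDown (suc h) c (false ∷ p) acc = cong suc (accepts⇒+numUp≡numDown h 0 p (BoolP.∧-conicalʳ _ _ acc))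

  multiplesBelow : ℕ → ℕ
  multiplesBelow zero    = 0
  multiplesBelow (suc x) = (if multiple x then 1 else 0) ℕ.+ multiplesBelow x

  multiplesBelow-≤j : ∀ x → x ≤ j′ → multiplesBelow (suc x) ≡ 1
  multiplesBelow-≤j zero    _   = refl
  multiplesBelow-≤j (suc x) x<j =
    trans (cong (λ b → (if b then 1 else 0) ℕ.+ multiplesBelow (suc x)) (multiple-< (s≤s z≤n) (s≤s x<j)))
          (multiplesBelow-≤j x (ℕP.≤-trans (ℕP.n≤1+n x) x<j))

  multiplesBelow-j+ : ∀ x → multiplesBelow (j ℕ.+ x) ≡ suc (multiplesBelow x)
  multiplesBelow-j+ zero    = trans (cong multiplesBelow (ℕP.+-identityʳ j)) (multiplesBelow-≤j j′ ℕP.≤-refl)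
  multiplesBelow-j+ (suc x) =
    trans (cong multiplesBelow (ℕP.+-suc j x))
          (trans (cong₂ (λ b y → (if b then 1 else 0) ℕ.+ y) (trans (cong multiple (ℕP.+-comm j x)) (multiple-+j x))
                                                          (multiplesBelow-j+ x))
                 (ℕP.+-suc _ (multiplesBelow x)))

  multiplesBelow-*j+ : ∀ t x → multiplesBelow (t ℕ.* j ℕ.+ x) ≡ t ℕ.+ multiplesBelow x
  multiplesBelow-*j+ zero    x = refl
  multiplesBelow-*j+ (suc t) x =
    trans (cong multiplesBelow (ℕP.+-assoc j (t ℕ.* j) x))
          (trans (multiplesBelow-j+ (t ℕ.* j ℕ.+ x)) (cong suc (multiplesBelow-*j+ t x)))

  landings-invariant : ∀ h c p → accepts h c p ≡ true → c ≤ h →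
                       j ℕ.* landings h p ≡ numUp p ℕ.+ c ℕ.+ j ℕ.* multiplesBelow (h ∸ c)
  landings-invariant h c [] acc c≤h with ≡ᵇ⇒≡ {h} {0} (BoolP.∧-conicalˡ _ _ acc) | c≤h
  ... | refl | z≤n = trans (ℕP.*-zeroʳ j) (sym (ℕP.*-zeroʳ j))
  landings-invariant h c (true ∷ p) acc c≤h =
    trans (landings-invariant (suc h) (suc c) p acc (s≤s c≤h))
          (cong (ℕ._+ j ℕ.* multiplesBelow (h ∸ c)) (ℕP.+-suc (numUp p) c))
  landings-invariant (suc h) c (false ∷ p) acc c≤h =
    begin
      j ℕ.* (δ ℕ.+ landings h p)
    ≡⟨ ℕP.*-distribˡ-+ j δ (landings h p) ⟩
      j ℕ.* δ ℕ.+ j ℕ.* landings h p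
    ≡⟨ cong (j ℕ.* δ ℕ.+_) (landings-invariant h 0 p (BoolP.∧-conicalʳ _ _ acc) z≤n) ⟩
      j ℕ.* δ ℕ.+ (numUp p ℕ.+ 0 ℕ.+ j ℕ.* multiplesBelow h)
    ≡⟨ collect j δ (numUp p) (multiplesBelow h) ⟩
      numUp p ℕ.+ j ℕ.* multiplesBelow (suc h)
    ≡⟨ cong (λ y → numUp p ℕ.+ j ℕ.* multiplesBelow y) (sym (ℕP.m+[n∸m]≡n c≤h)) ⟩
      numUp p ℕ.+ j ℕ.* multiplesBelow (c ℕ.+ (suc h ∸ c))
    ≡⟨ cong (λ y → numUp p ℕ.+ j ℕ.* multiplesBelow (y ℕ.+ (suc h ∸ c))) c≡ ⟩
      numUp p ℕ.+ j ℕ.* multiplesBelow ((c / j) ℕ.* j ℕ.+ (suc h ∸ c))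
    ≡⟨ cong (λ y → numUp p ℕ.+ j ℕ.* y) (multiplesBelow-*j+ (c / j) (suc h ∸ c)) ⟩
      numUp p ℕ.+ j ℕ.* (c / j ℕ.+ multiplesBelow (suc h ∸ c))
    ≡⟨ expand (numUp p) j (c / j) (multiplesBelow (suc h ∸ c)) ⟩
      numUp p ℕ.+ (c / j) ℕ.* j ℕ.+ j ℕ.* multiplesBelow (suc h ∸ c)
    ≡⟨ cong (λ y → numUp p ℕ.+ y ℕ.+ j ℕ.* multiplesBelow (suc h ∸ c)) (sym c≡) ⟩
      numUp p ℕ.+ c ℕ.+ j ℕ.* multiplesBelow (suc h ∸ c)
    ∎
    where
    open ≡-Reasoning
    δ = if multiple h then 1 else 0
    c≡ : c ≡ (c / j) ℕ.* j
    c≡ = multiple⇒≡*j (BoolP.∧-conicalˡ _ _ acc)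
    collect : ∀ a b u v → a ℕ.* b ℕ.+ (u ℕ.+ 0 ℕ.+ a ℕ.* v) ≡ u ℕ.+ a ℕ.* (b ℕ.+ v)
    collect = ℕSolver.solve-∀
    expand : ∀ u a t v → u ℕ.+ a ℕ.* (t ℕ.+ v) ≡ u ℕ.+ t ℕ.* a ℕ.+ a ℕ.* v
    expand = ℕSolver.solve-∀

  leadingDowns : Path → ℕ
  leadingDowns (false ∷ p) = suc (leadingDowns p)
  leadingDowns _           = 0

  dropDowns : Path → Path
  dropDowns (false ∷ p) = dropDowns p
  dropDowns p           = p

  descendsAtLeast≡≤ᵇ : ∀ k p → descendsAtLeast k p ≡ (k ℕ.≤ᵇ leadingDowns p)
  descendsAtLeast≡≤ᵇ zero          p           = refl
  descendsAtLeast≡≤ᵇ (suc k)       []          = refl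
  descendsAtLeast≡≤ᵇ (suc k)       (true ∷ p)  = refl
  descendsAtLeast≡≤ᵇ (suc zero)    (false ∷ p) = refl
  descendsAtLeast≡≤ᵇ (suc (suc k)) (false ∷ p) = descendsAtLeast≡≤ᵇ (suc k) p

  runs-downs : ∀ p → consRun (false , 1) (runs p) ≡ (false , suc (leadingDowns p)) ∷ runs (dropDowns p)
  runs-downs []          = refl
  runs-downs (false ∷ p) = trans (cong (consRun (false , 1)) (runs-∷ false p)) (cong (consRun (false , 1)) (runs-downs p))
  runs-downs (true ∷ p)  = trans (cong (consRun (false , 1)) (runs-∷ true p))
                                 (trans (down-up (runs p)) (cong ((false , 1) ∷_) (sym (runs-∷ true p))))
    where
    down-up : ∀ rs → consRun (false , 1) (consRun (true , 1) rs) ≡ (false , 1) ∷ consRun (true , 1) rs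
    down-up []                = refl
    down-up ((true , l) ∷ r)  = refl
    down-up ((false , l) ∷ r) = refl

  npaFrom-consRun-down : ∀ h rs → npaFrom j h (consRun (false , 1) rs) ≡ npaFrom j (h ∸ 1) rs
  npaFrom-consRun-down h []                = refl
  npaFrom-consRun-down h ((false , l) ∷ r) = cong (λ h′ → npaFrom j h′ r) (sym (ℕP.∸-+-assoc h 1 l))
  npaFrom-consRun-down h ((true , l) ∷ r)  = refl

  npaFrom-runs : ∀ p h → accepts h 0 p ≡ true → npaFrom j h (runs p) ≡ nicePyramids h true p
  npaFrom-ascent : ∀ p h k → accepts (suc k ℕ.+ h) (suc k) p ≡ true →
    npaFrom j h (consRun (true , suc k) (runs p))
      ≡ (if multiple h ∧ descendsAtLeast (suc k ℕ.+ leadingUps p) (dropUps p) then 1 else 0)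
        ℕ.+ nicePyramids (suc k ℕ.+ h) false p

  npaFrom-runs []          h       acc = refl
  npaFrom-runs (true ∷ p)  h       acc = trans (cong (npaFrom j h) (runs-∷ true p)) (npaFrom-ascent p h 0 acc)
  npaFrom-runs (false ∷ p) (suc h) acc =
    trans (cong (npaFrom j (suc h)) (runs-∷ false p))
          (trans (npaFrom-consRun-down (suc h) (runs p)) (npaFrom-runs p h (BoolP.∧-conicalʳ _ _ acc)))

  npaFrom-ascent []          h k acc = cong (λ b → (if b then 1 else 0) ℕ.+ 0) (sym (BoolP.∧-zeroʳ (multiple h)))
  npaFrom-ascent (true ∷ p)  h k acc =
    trans (cong (λ rs → npaFrom j h (consRun (true , suc k) rs)) (runs-∷ true p))
    (trans (cong (npaFrom j h) (consRun-up-up (suc k) (runs p)))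
    (trans (npaFrom-ascent p h (suc k) acc)
           (cong (λ u → (if multiple h ∧ descendsAtLeast u (dropUps p) then 1 else 0) ℕ.+ nicePyramids (suc (suc k ℕ.+ h)) false p)
                 (sym (ℕP.+-suc (suc k) (leadingUps p))))))
  npaFrom-ascent (false ∷ p) h k acc =
    begin
      npaFrom j h (consRun (true , suc k) (runs (false ∷ p)))
    ≡⟨ cong (λ rs → npaFrom j h (consRun (true , suc k) rs)) (trans (runs-∷ false p) (runs-downs p)) ⟩
      (if (suc k ℕ.≤ᵇ suc (leadingDowns p)) ∧ ((h ℕ.+ suc k) % j ≡ᵇ 0) then 1 else 0)
      ℕ.+ npaFrom j ((h ℕ.+ suc k) ∸ suc (leadingDowns p)) (runs (dropDowns p))
    ≡⟨ cong₂ (λ b y → (if b then 1 else 0) ℕ.+ y) pyramid rest ⟩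
      (if multiple h ∧ descendsAtLeast (k ℕ.+ 0) p then 1 else 0) ℕ.+ nicePyramids (k ℕ.+ h) true p
    ∎
    where
    open ≡-Reasoning
    pyramid : (suc k ℕ.≤ᵇ suc (leadingDowns p)) ∧ ((h ℕ.+ suc k) % j ≡ᵇ 0) ≡ multiple h ∧ descendsAtLeast (k ℕ.+ 0) p
    pyramid = trans (cong₂ _∧_ (trans (sym (descendsAtLeast≡≤ᵇ (suc k) (false ∷ p)))
                                      (cong (λ u → descendsAtLeast u p) (sym (ℕP.+-identityʳ k))))
                               (multiple-+ h (BoolP.∧-conicalˡ _ _ acc)))
                    (BoolP.∧-comm (descendsAtLeast (k ℕ.+ 0) p) (multiple h))
    rest : npaFrom j ((h ℕ.+ suc k) ∸ suc (leadingDowns p)) (runs (dropDowns p)) ≡ nicePyramids (k ℕ.+ h) true p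
    rest = trans (cong (npaFrom j (h ℕ.+ suc k)) (sym (runs-downs p)))
           (trans (npaFrom-consRun-down (h ℕ.+ suc k) (runs p))
           (trans (cong (λ h′ → npaFrom j h′ (runs p)) (trans (cong (_∸ 1) (ℕP.+-suc h k)) (ℕP.+-comm h k)))
                  (npaFrom-runs p (k ℕ.+ h) (BoolP.∧-conicalʳ _ _ acc))))

  npa≡nicePyramids : ∀ p → accepts 0 0 p ≡ true → npa j p ≡ nicePyramids 0 true p
  npa≡nicePyramids p = npaFrom-runs p 0

-- Counting paths by length

module Counting (j′ : ℕ) where

  open JDyck j′

  twoJ : ℕ
  twoJ = 2 ℕ.* j

  instance
    twoJ-nonZero : ℕ.NonZero twoJ
    twoJ-nonZero = ℕP.m*n≢0 2 j

  -- [x^(i/2j) y^m] W^e, indexed by a path length i: a j-Dyck path of size k has length 2jk.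
  Wℓ : ℕ → ℕ → ℕ → ℤ
  Wℓ e i m = if i % twoJ ≡ᵇ 0 then powS W e (i / twoJ) m else 0ℤ

  Wℓ-< : ∀ e {i} m → i < twoJ → Wℓ e i m ≡ (if i ≡ᵇ 0 then powS W e 0 m else 0ℤ)
  Wℓ-< e {zero}  m _     = cong (λ q → powS W e q m) (ℕDM.0/n≡0 twoJ)
  Wℓ-< e {suc i} m i<2j  = cong (λ r → if r ≡ᵇ 0 then powS W e (suc i / twoJ) m else 0ℤ) (ℕDM.m<n⇒m%n≡m i<2j)

  Wℓ-+ : ∀ e i m → Wℓ e (twoJ ℕ.+ i) m ≡ (if i % twoJ ≡ᵇ 0 then powS W e (suc (i / twoJ)) m else 0ℤ)
  Wℓ-+ e i m = cong₂ (λ r q → if r ≡ᵇ 0 then powS W e q m else 0ℤ)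
                     (trans (cong (_% twoJ) (ℕP.+-comm twoJ i)) (ℕDM.[m+n]%n≡m%n i twoJ))
                     (trans (ℕDM.m/n≡1+[m∸n]/n (ℕP.m≤m+n twoJ i)) (cong (λ k → suc (k / twoJ)) (ℕP.m+n∸m≡n twoJ i)))

  Wℓ-0-0 : ∀ m → Wℓ 0 0 m ≡ 𝟙 (0 ≡ᵇ m)
  Wℓ-0-0 zero    = refl
  Wℓ-0-0 (suc m) = refl

  Wℓ-0-suc : ∀ i m → Wℓ 0 (suc i) m ≡ 0ℤ
  Wℓ-0-suc i m = <-or-+ twoJ {λ i → 0 < i → Wℓ 0 i m ≡ 0ℤ} below above (suc i) (s≤s z≤n)
    where
    below : ∀ {i} → i < twoJ → 0 < i → Wℓ 0 i m ≡ 0ℤ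
    below {suc i} i<2j _ = Wℓ-< 0 m i<2j
    above : ∀ i → 0 < twoJ ℕ.+ i → Wℓ 0 (twoJ ℕ.+ i) m ≡ 0ℤ
    above i _ = trans (Wℓ-+ 0 i m) (if-zero (i % twoJ ≡ᵇ 0))
      where
      if-zero : ∀ b → (if b then oneS (suc (i / twoJ)) m else 0ℤ) ≡ 0ℤ
      if-zero true  = refl
      if-zero false = refl

  -- (1 - xy) W^(s+1) = (1 - x) W^s, where x acts as delay twoJ on lengths and y as delay 1 on m.
  Wℓ-suc : ∀ s i m → Wℓ (suc s) i m ≡
    Wℓ s i m - delay twoJ (λ i → Wℓ s i m) i + delay twoJ (λ i → delay 1 (Wℓ (suc s) i) m) i
  Wℓ-suc s i m = <-or-+ twoJ {Recurrence} below above i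
    where
    Recurrence : ℕ → Set
    Recurrence i = Wℓ (suc s) i m ≡
      Wℓ s i m - delay twoJ (λ i → Wℓ s i m) i + delay twoJ (λ i → delay 1 (Wℓ (suc s) i) m) i

    below : ∀ {i} → i < twoJ → Recurrence i
    below {i} i<2j =
      begin
        Wℓ (suc s) i m
      ≡⟨ trans (Wℓ-< (suc s) m i<2j) (cong (λ w → if i ≡ᵇ 0 then w else 0ℤ) (W⊛-zero (powS W s) m)) ⟩
        (if i ≡ᵇ 0 then powS W s 0 m else 0ℤ)
      ≡⟨ sym (trans (cong (λ w → w - 0ℤ + 0ℤ) (Wℓ-< s m i<2j)) (plus-zeros _)) ⟩
        Wℓ s i m - 0ℤ + 0ℤ
      ≡⟨ sym (cong₂ (λ u v → Wℓ s i m - u + v) (delay-< twoJ (λ i → Wℓ s i m) i<2j)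
                                               (delay-< twoJ (λ i → delay 1 (Wℓ (suc s) i) m) i<2j)) ⟩
        Wℓ s i m - delay twoJ (λ i → Wℓ s i m) i + delay twoJ (λ i → delay 1 (Wℓ (suc s) i) m) i
      ∎
      where
      open ≡-Reasoning
      plus-zeros : ∀ x → x - 0ℤ + 0ℤ ≡ x
      plus-zeros = solve-∀

    coefficientStep : ∀ b q m →
      (if b then powS W (suc s) (suc q) m else 0ℤ) ≡
      (if b then powS W s (suc q) m else 0ℤ) - (if b then powS W s q m else 0ℤ)
        + delay 1 (λ m → if b then powS W (suc s) q m else 0ℤ) m
    coefficientStep false q m       = trans (sym (delay-zero 1 m)) (sym (ℤP.+-identityˡ _))
    coefficientStep true  q zero    = trans (W⊛-suc-zero (powS W s) q) (sym (ℤP.+-identityʳ _))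
    coefficientStep true  q (suc m) = W⊛-suc-suc (powS W s) q m

    above : ∀ i → Recurrence (twoJ ℕ.+ i)
    above i =
      begin
        Wℓ (suc s) (twoJ ℕ.+ i) m
      ≡⟨ Wℓ-+ (suc s) i m ⟩
        (if b then powS W (suc s) (suc q) m else 0ℤ)
      ≡⟨ coefficientStep b q m ⟩
        (if b then powS W s (suc q) m else 0ℤ) - Wℓ s i m + delay 1 (Wℓ (suc s) i) m
      ≡⟨ sym (cong₂ (λ u v → u - v + delay 1 (Wℓ (suc s) i) m) (Wℓ-+ s i m) (delay-+ twoJ (λ i → Wℓ s i m) i)) ⟩
        Wℓ s (twoJ ℕ.+ i) m - delay twoJ (λ i → Wℓ s i m) (twoJ ℕ.+ i) + delay 1 (Wℓ (suc s) i) m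
      ≡⟨ sym (cong (Wℓ s (twoJ ℕ.+ i) m - delay twoJ (λ i → Wℓ s i m) (twoJ ℕ.+ i) +_)
                   (delay-+ twoJ (λ i → delay 1 (Wℓ (suc s) i) m) i)) ⟩
        Wℓ s (twoJ ℕ.+ i) m - delay twoJ (λ i → Wℓ s i m) (twoJ ℕ.+ i)
          + delay twoJ (λ i → delay 1 (Wℓ (suc s) i) m) (twoJ ℕ.+ i)
      ∎
      where
      open ≡-Reasoning
      b = i % twoJ ≡ᵇ 0
      q = i / twoJ

  npaCount : ℕ → ℕ → Bool → ℕ → ℕ → ℤ
  npaCount h c v L m = count L (λ p → accepts h c p ∧ (nicePyramids h v p ≡ᵇ m))

  slotSum : ℕ → ℕ → Bool → ℕ → ℕ → ℤ
  slotSum h c v L m =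
    sumTo L (λ L′ → sumPaths L′ (λ Q → if accepts h c Q then Wℓ (slots h v Q) (L ∸ L′) m else 0ℤ))

  afterDown : (ℕ → ℤ) → ℕ → ℕ → ℤ
  afterDown F zero    c = 0ℤ
  afterDown F (suc h) c = if multiple c then F h else 0ℤ

  npaCount≡slotSum-0 : ∀ h c v m → niceStart h v ≡ false → npaCount h c v 0 m ≡ slotSum h c v 0 m
  npaCount≡slotSum-0 h c v m notNice =
    trans (sumPaths-zero (λ p → 𝟙 (accepts h c p ∧ (nicePyramids h v p ≡ᵇ m))))
          (trans (emptyPath (accepts h c []))
                 (sym (sumPaths-zero (λ Q → if accepts h c Q then Wℓ (slots h v Q) 0 m else 0ℤ))))
    where
    emptyPath : ∀ b → 𝟙 (b ∧ (0 ≡ᵇ m)) ≡ (if b then Wℓ (slots h v []) 0 m else 0ℤ)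
    emptyPath false = refl
    emptyPath true  = sym (trans (cong (λ s → Wℓ s 0 m) (cong (λ b → (if b then 1 else 0) ℕ.+ 0) notNice)) (Wℓ-0-0 m))

  npaCount-suc : ∀ h c v L m → niceStart h v ≡ false →
    npaCount h c v (suc L) m ≡ npaCount (suc h) (suc c) false L m + afterDown (λ h → npaCount h 0 true L m) h c
  npaCount-suc h c v L m notNice =
    trans (count-suc L (λ p → accepts h c p ∧ (nicePyramids h v p ≡ᵇ m)))
          (cong₂ _+_ (count-cong L (λ p → cong (λ b → accepts (suc h) (suc c) p ∧
                                                   (((if b then 1 else 0) ℕ.+ nicePyramids (suc h) false p) ≡ᵇ m))
                                               (cong (_∧ startsWithPyramid (true ∷ p)) notNice)))
                     (down h))
    where
    down : ∀ h → count L (λ p → accepts h c (false ∷ p) ∧ (nicePyramids h v (false ∷ p) ≡ᵇ m))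
                 ≡ afterDown (λ h → npaCount h 0 true L m) h c
    down zero = count-none L
    down (suc h) with multiple c
    ... | true  = refl
    ... | false = count-none L

  slotSum-suc : ∀ h c v L m → niceStart h v ≡ false →
    slotSum h c v (suc L) m ≡ slotSum (suc h) (suc c) false L m + afterDown (λ h → slotSum h 0 true L m) h c
  slotSum-suc h c v L m notNice =
    begin
      sumTo (suc L) (λ L′ → sumPaths L′ (term L′))
    ≡⟨ sumTo-sucˡ L (λ L′ → sumPaths L′ (term L′)) ⟩
      sumPaths 0 (term 0) + sumTo L (λ L′ → sumPaths (suc L′) (term (suc L′)))
    ≡⟨ cong₂ _+_ emptyPath (sumTo-cong L (λ L′ → sumPaths-suc L′ (term (suc L′)))) ⟩
      0ℤ + sumTo L (λ L′ → sumPaths L′ (term (suc L′) ∘ (true ∷_)) + sumPaths L′ (term (suc L′) ∘ (false ∷_)))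
    ≡⟨ trans (ℤP.+-identityˡ _) (sumTo-+ L _ _) ⟩
      sumTo L (λ L′ → sumPaths L′ (term (suc L′) ∘ (true ∷_))) + sumTo L (λ L′ → sumPaths L′ (term (suc L′) ∘ (false ∷_)))
    ≡⟨ cong₂ _+_ (sumTo-cong L (λ L′ → sumOver-cong (allPaths L′) (λ Q →
                    cong (λ s → if accepts (suc h) (suc c) Q then Wℓ s (L ∸ L′) m else 0ℤ)
                         (cong (λ b → (if b then 1 else 0) ℕ.+ landings (suc h) Q) notNice))))
                 (down h notNice) ⟩
      slotSum (suc h) (suc c) false L m + afterDown (λ h → slotSum h 0 true L m) h c
    ∎
    where
    open ≡-Reasoning
    term : ℕ → Path → ℤ
    term L′ Q = if accepts h c Q then Wℓ (slots h v Q) (suc L ∸ L′) m else 0ℤ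

    emptyPath : sumPaths 0 (term 0) ≡ 0ℤ
    emptyPath = trans (sumPaths-zero (term 0)) (vanish (accepts h c []))
      where
      vanish : ∀ b → (if b then Wℓ (slots h v []) (suc L) m else 0ℤ) ≡ 0ℤ
      vanish false = refl
      vanish true  = trans (cong (λ s → Wℓ s (suc L) m) (cong (λ b → (if b then 1 else 0) ℕ.+ 0) notNice)) (Wℓ-0-suc L m)

    down : ∀ h → niceStart h v ≡ false →
           sumTo L (λ L′ → sumPaths L′ (λ Q → if accepts h c (false ∷ Q)
                                               then Wℓ (slots h v (false ∷ Q)) (L ∸ L′) m else 0ℤ))
           ≡ afterDown (λ h → slotSum h 0 true L m) h c
    down zero    _ = sumTo-zero L (λ L′ _ → sumOver-zero (allPaths L′) (λ Q → refl))
    down (suc h) notNice with multiple c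
    ... | true  rewrite notNice = refl
    ... | false = sumTo-zero L (λ L′ _ → sumOver-zero (allPaths L′) (λ Q → refl))

  sumPaths-if-delay : ∀ L (P : Path → Bool) d (F : Path → ℕ → ℤ) i →
    sumPaths L (λ Q → if P Q then delay d (F Q) i else 0ℤ)
      ≡ delay d (λ i → sumPaths L (λ Q → if P Q then F Q i else 0ℤ)) i
  sumPaths-if-delay L P d F i =
    trans (sumOver-cong (allPaths L) (λ Q → delay-if (P Q) d (F Q) i))
          (delay-linear (sumPaths L) (sumOver-zero (allPaths L) (λ _ → refl)) d (λ Q i → if P Q then F Q i else 0ℤ) i)

  slotSum-nice : ∀ h L m → multiple h ≡ true →
    slotSum h 0 true L m ≡ slotSum h 0 false L m - delay twoJ (λ L → slotSum h 0 false L m) L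
                           + delay twoJ (λ L → delay 1 (slotSum h 0 true L) m) L
  slotSum-nice h L m nice =
    begin
      sumTo L (λ L′ → sumPaths L′ (λ Q → if acc Q then Wℓ (slots h true Q) (L ∸ L′) m else 0ℤ))
    ≡⟨ sumTo-cong L (λ L′ → sumOver-cong (allPaths L′) (λ Q → split Q (L ∸ L′))) ⟩
      sumTo L (λ L′ → sumPaths L′ (λ Q → A L′ Q - B L′ Q + C L′ Q))
    ≡⟨ sumTo-cong L (λ L′ → trans (sumOver-+ (allPaths L′) (λ Q → A L′ Q - B L′ Q) (C L′))
                                  (cong (_+ sumPaths L′ (C L′))
                                        (trans (sumOver-+ (allPaths L′) (A L′) (λ Q → - B L′ Q))
                                               (cong (sumPaths L′ (A L′) +_) (sumOver-neg (allPaths L′) (B L′)))))) ⟩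
      sumTo L (λ L′ → sumPaths L′ (A L′) - sumPaths L′ (B L′) + sumPaths L′ (C L′))
    ≡⟨ trans (sumTo-+ L _ _) (cong (_+ sumTo L (λ L′ → sumPaths L′ (C L′)))
                                   (trans (sumTo-+ L _ _) (cong (slotSum h 0 false L m +_) (sumTo-neg L _)))) ⟩
      slotSum h 0 false L m - sumTo L (λ L′ → sumPaths L′ (B L′)) + sumTo L (λ L′ → sumPaths L′ (C L′))
    ≡⟨ cong₂ (λ u v → slotSum h 0 false L m - u + v) ΣB ΣC ⟩
      slotSum h 0 false L m - delay twoJ (λ L → slotSum h 0 false L m) L
        + delay twoJ (λ L → delay 1 (slotSum h 0 true L) m) L
    ∎
    where
    open ≡-Reasoning
    acc : Path → Bool
    acc = accepts h 0
    s : Path → ℕ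
    s = slots h false

    slots-nice : ∀ Q → slots h true Q ≡ suc (s Q)
    slots-nice Q rewrite nice = refl

    A B C : ℕ → Path → ℤ
    A L′ Q = if acc Q then Wℓ (s Q) (L ∸ L′) m else 0ℤ
    B L′ Q = if acc Q then delay twoJ (λ i → Wℓ (s Q) i m) (L ∸ L′) else 0ℤ
    C L′ Q = if acc Q then delay twoJ (λ i → delay 1 (Wℓ (suc (s Q)) i) m) (L ∸ L′) else 0ℤ

    split : ∀ Q i → (if acc Q then Wℓ (slots h true Q) i m else 0ℤ)
                    ≡ (if acc Q then Wℓ (s Q) i m else 0ℤ)
                      - (if acc Q then delay twoJ (λ i → Wℓ (s Q) i m) i else 0ℤ)
                      + (if acc Q then delay twoJ (λ i → delay 1 (Wℓ (suc (s Q)) i) m) i else 0ℤ)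
    split Q i = trans (cong (λ e → if acc Q then Wℓ e i m else 0ℤ) (slots-nice Q)) (byCases (acc Q))
      where
      byCases : ∀ b → (if b then Wℓ (suc (s Q)) i m else 0ℤ)
                      ≡ (if b then Wℓ (s Q) i m else 0ℤ)
                        - (if b then delay twoJ (λ i → Wℓ (s Q) i m) i else 0ℤ)
                        + (if b then delay twoJ (λ i → delay 1 (Wℓ (suc (s Q)) i) m) i else 0ℤ)
      byCases true  = Wℓ-suc (s Q) i m
      byCases false = refl

    ΣB : sumTo L (λ L′ → sumPaths L′ (B L′)) ≡ delay twoJ (λ L → slotSum h 0 false L m) L
    ΣB = trans (sumTo-cong L (λ L′ → sumPaths-if-delay L′ acc twoJ (λ Q i → Wℓ (s Q) i m) (L ∸ L′)))
               (delay-sumTo twoJ (λ L′ i → sumPaths L′ (λ Q → if acc Q then Wℓ (s Q) i m else 0ℤ)) L)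

    ΣC : sumTo L (λ L′ → sumPaths L′ (C L′)) ≡ delay twoJ (λ L → delay 1 (slotSum h 0 true L) m) L
    ΣC = trans (sumTo-cong L (λ L′ → sumPaths-if-delay L′ acc twoJ (λ Q i → delay 1 (Wℓ (suc (s Q)) i) m) (L ∸ L′)))
         (trans (delay-sumTo twoJ (λ L′ i → sumPaths L′ (λ Q → if acc Q then delay 1 (Wℓ (suc (s Q)) i) m else 0ℤ)) L)
                (delay-cong twoJ L (λ L₀ _ →
                   trans (sumTo-cong L₀ (λ L′ → sumPaths-if-delay L′ acc 1 (λ Q m → Wℓ (suc (s Q)) (L₀ ∸ L′) m) m))
                   (trans (delay-linear (sumTo L₀) (sumTo-zero L₀ (λ _ _ → refl)) 1
                                        (λ L′ m → sumPaths L′ (λ Q → if acc Q then Wℓ (suc (s Q)) (L₀ ∸ L′) m else 0ℤ)) m)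
                          (delay-cong 1 m (λ m′ _ → sumTo-cong L₀ (λ L′ → sumOver-cong (allPaths L′) (λ Q →
                             cong (λ e → if acc Q then Wℓ e (L₀ ∸ L′) m′ else 0ℤ) (sym (slots-nice Q))))))))))

  module NiceStart (h : ℕ) (nice : multiple h ≡ true) where

    N⁺ N⁻ : ℕ → ℕ → ℤ
    N⁺ L m = npaCount h 0 true  L m
    N⁻ L m = npaCount h 0 false L m

    pyramidStart : ℕ → Path → Bool
    pyramidStart m p = (accepts h 0 p ∧ (nicePyramids h false p ≡ᵇ m)) ∧ startsWithPyramid p

    pyramidCount otherCount : ℕ → ℕ → ℤ
    pyramidCount L m = count L (pyramidStart m)
    otherCount   L m = count L (λ p → (accepts h 0 p ∧ (nicePyramids h false p ≡ᵇ m)) ∧ not (startsWithPyramid p))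

    N⁻≡ : ∀ L m → N⁻ L m ≡ pyramidCount L m + otherCount L m
    N⁻≡ L m = count-partition L (λ p → accepts h 0 p ∧ (nicePyramids h false p ≡ᵇ m)) startsWithPyramid

    nicePyramids-nice : ∀ p → nicePyramids h true p ≡ (if startsWithPyramid p then 1 else 0) ℕ.+ nicePyramids h false p
    nicePyramids-nice []          = refl
    nicePyramids-nice (false ∷ p) = refl
    nicePyramids-nice (true ∷ p) rewrite nice = refl

    N⁺≡ : ∀ L m → N⁺ L m ≡ otherCount L m + delay 1 (pyramidCount L) m
    N⁺≡ L m =
      trans (count-partition L (λ p → accepts h 0 p ∧ (nicePyramids h true p ≡ᵇ m)) startsWithPyramid)
      (trans (ℤP.+-comm (count L (λ p → (accepts h 0 p ∧ (nicePyramids h true p ≡ᵇ m)) ∧ startsWithPyramid p)) _)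
             (cong₂ _+_ (count-cong L (λ p → trans (cong (λ k → (accepts h 0 p ∧ (k ≡ᵇ m)) ∧ not (startsWithPyramid p))
                                                          (nicePyramids-nice p))
                                                    (other (accepts h 0 p) (startsWithPyramid p) _)))
                        (pyramids m)))
      where
      other : ∀ a b x → (a ∧ (((if b then 1 else 0) ℕ.+ x) ≡ᵇ m)) ∧ not b ≡ (a ∧ (x ≡ᵇ m)) ∧ not b
      other a true  x = trans (BoolP.∧-zeroʳ _) (sym (BoolP.∧-zeroʳ _))
      other a false x = refl

      pyramid-zero : ∀ a b x → (a ∧ (((if b then 1 else 0) ℕ.+ x) ≡ᵇ 0)) ∧ b ≡ false
      pyramid-zero a true  x = cong (_∧ true) (BoolP.∧-zeroʳ a)
      pyramid-zero a false x = BoolP.∧-zeroʳ _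

      pyramid-suc : ∀ a b x m′ → (a ∧ (((if b then 1 else 0) ℕ.+ x) ≡ᵇ suc m′)) ∧ b ≡ (a ∧ (x ≡ᵇ m′)) ∧ b
      pyramid-suc a true  x m′ = refl
      pyramid-suc a false x m′ = trans (BoolP.∧-zeroʳ _) (sym (BoolP.∧-zeroʳ _))

      pyramids : ∀ m → count L (λ p → (accepts h 0 p ∧ (nicePyramids h true p ≡ᵇ m)) ∧ startsWithPyramid p)
                       ≡ delay 1 (pyramidCount L) m
      pyramids zero     = trans (count-cong L (λ p → trans (cong (λ k → (accepts h 0 p ∧ (k ≡ᵇ 0)) ∧ startsWithPyramid p)
                                                                  (nicePyramids-nice p))
                                                            (pyramid-zero (accepts h 0 p) (startsWithPyramid p) _)))
                                (count-none L)
      pyramids (suc m′) = count-cong L (λ p → trans (cong (λ k → (accepts h 0 p ∧ (k ≡ᵇ suc m′)) ∧ startsWithPyramid p)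
                                                         (nicePyramids-nice p))
                                                   (pyramid-suc (accepts h 0 p) (startsWithPyramid p) _ m′))

    module _ (m : ℕ) where

      -- climbing a: the first a up-steps of a leading pyramid ascent have been read;
      -- falling b: b down-steps finishing such a pyramid are still to come.
      climbing falling : ℕ → Path → Bool
      climbing a p = (accepts (a ℕ.+ h) a p ∧ (nicePyramids (a ℕ.+ h) false p ≡ᵇ m))
                     ∧ descendsAtLeast (a ℕ.+ leadingUps p) (dropUps p)
      falling  b p = (accepts (b ℕ.+ h) 0 p ∧ (nicePyramids (b ℕ.+ h) true p ≡ᵇ m)) ∧ descendsAtLeast b p

      climbCount fallCount : ℕ → ℕ → ℤ
      climbCount a L = count L (climbing a)
      fallCount  b L = count L (falling b)

      climbCount-zero : ∀ a → climbCount (suc a) 0 ≡ 0ℤ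
      climbCount-zero a =
        count-zero (climbing (suc a)) (BoolP.∧-zeroʳ (accepts (suc a ℕ.+ h) (suc a) [] ∧ (0 ≡ᵇ m)))

      pyramidCount≡climbCount : ∀ L → pyramidCount L m ≡ climbCount 1 (ℕ.pred L)
      pyramidCount≡climbCount zero    =
        trans (count-zero (pyramidStart m) (BoolP.∧-zeroʳ _)) (sym (climbCount-zero 0))
      pyramidCount≡climbCount (suc L) =
        trans (count-suc L (pyramidStart m))
              (trans (cong (climbCount 1 L +_) (trans (count-cong L (λ p → BoolP.∧-zeroʳ (accepts h 0 (false ∷ p) ∧ _)))
                                                      (count-none L)))
                                     (ℤP.+-identityʳ _))

      fallCount≡delay : ∀ b L → fallCount b L ≡ delay b (λ L → N⁺ L m) L
      fallCount≡delay zero    L       = count-cong L (λ _ → BoolP.∧-identityʳ _)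
      fallCount≡delay (suc b) zero    =
        count-zero (falling (suc b)) (BoolP.∧-zeroʳ (accepts (suc b ℕ.+ h) 0 [] ∧ (0 ≡ᵇ m)))
      fallCount≡delay (suc b) (suc L) =
        trans (count-suc L (falling (suc b)))
              (trans (cong (_+ fallCount b L) (trans (count-cong L (λ _ → BoolP.∧-zeroʳ _)) (count-none L)))
                     (trans (ℤP.+-identityˡ _) (fallCount≡delay b L)))

      climbCount-suc : ∀ a L → climbCount (suc a) (suc L)
                               ≡ climbCount (suc (suc a)) L + (if multiple (suc a) then fallCount a L else 0ℤ)
      climbCount-suc a L =
        trans (count-suc L (climbing (suc a)))
              (cong₂ _+_ (count-cong L (λ p → cong (λ d → (accepts (suc (suc (a ℕ.+ h))) (suc (suc a)) p
                                                              ∧ (nicePyramids (suc (suc (a ℕ.+ h))) false p ≡ᵇ m))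
                                                             ∧ descendsAtLeast d (dropUps p))
                                                   (ℕP.+-suc (suc a) (leadingUps p))))
                         (down (multiple (suc a))))
        where
        down : ∀ b → count L (λ p → ((b ∧ accepts (a ℕ.+ h) 0 p) ∧ (nicePyramids (a ℕ.+ h) true p ≡ᵇ m))
                                    ∧ descendsAtLeast (a ℕ.+ 0) p)
                     ≡ (if b then fallCount a L else 0ℤ)
        down true  = count-cong L (λ p → cong (λ d → (accepts (a ℕ.+ h) 0 p ∧ (nicePyramids (a ℕ.+ h) true p ≡ᵇ m))
                                                      ∧ descendsAtLeast d p)
                                               (ℕP.+-identityʳ a))
        down false = count-none L

      climbCount-+j : ∀ L a → climbCount (suc a ℕ.+ j) L ≡ climbCount (suc a) (L ∸ j)
      climbCount-+j zero     a = trans (climbCount-zero (a ℕ.+ j)) (sym (climbCount-zero a))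
      climbCount-+j (suc L′) a with ℕP.<-≤-connex L′ j
      ... | inj₂ j≤L′ =
        begin
          climbCount (suc (a ℕ.+ j)) (suc L′)
        ≡⟨ climbCount-suc (a ℕ.+ j) L′ ⟩
          climbCount (suc (suc (a ℕ.+ j))) L′ + (if multiple (suc a ℕ.+ j) then fallCount (a ℕ.+ j) L′ else 0ℤ)
        ≡⟨ cong₂ _+_ (climbCount-+j L′ (suc a)) (cong₂ (λ b x → if b then x else 0ℤ) (multiple-+j (suc a)) falls) ⟩
          climbCount (suc (suc a)) (L′ ∸ j) + (if multiple (suc a) then fallCount a (L′ ∸ j) else 0ℤ)
        ≡⟨ sym (climbCount-suc a (L′ ∸ j)) ⟩
          climbCount (suc a) (suc (L′ ∸ j))
        ≡⟨ cong (climbCount (suc a)) (sym (ℕP.+-∸-assoc 1 j≤L′)) ⟩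
          climbCount (suc a) (suc L′ ∸ j)
        ∎
        where
        open ≡-Reasoning
        falls : fallCount (a ℕ.+ j) L′ ≡ fallCount a (L′ ∸ j)
        falls = trans (fallCount≡delay (a ℕ.+ j) L′)
                (trans (cong (delay (a ℕ.+ j) (λ L → N⁺ L m)) (sym (ℕP.m+[n∸m]≡n j≤L′)))
                (trans (delay-shift a j (λ L → N⁺ L m) (L′ ∸ j)) (sym (fallCount≡delay a (L′ ∸ j)))))
      ... | inj₁ L′<j =
        trans (climbCount-suc (a ℕ.+ j) L′)
              (trans (cong₂ _+_ (trans (climbCount-+j L′ (suc a))
                                       (trans (cong (climbCount (suc (suc a))) (ℕP.m≤n⇒m∸n≡0 (ℕP.<⇒≤ L′<j))) (climbCount-zero (suc a))))
                                (noFall (multiple (suc a ℕ.+ j))))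
                     (sym (trans (cong (climbCount (suc a)) (ℕP.m≤n⇒m∸n≡0 L′<j)) (climbCount-zero a))))
        where
        noFall : ∀ b → (if b then fallCount (a ℕ.+ j) L′ else 0ℤ) ≡ 0ℤ
        noFall true  = trans (fallCount≡delay (a ℕ.+ j) L′) (delay-< (a ℕ.+ j) _ (ℕP.<-≤-trans L′<j (ℕP.m≤n+m j a)))
        noFall false = refl

      climbCount-skip : ∀ s a X → suc a ℕ.+ s ≤ j → climbCount (suc a) (s ℕ.+ X) ≡ climbCount (suc a ℕ.+ s) X
      climbCount-skip zero    a X _     = cong (λ b → climbCount b X) (sym (ℕP.+-identityʳ (suc a)))
      climbCount-skip (suc s) a X bound =
        begin
          climbCount (suc a) (suc (s ℕ.+ X))
        ≡⟨ climbCount-suc a (s ℕ.+ X) ⟩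
          climbCount (suc (suc a)) (s ℕ.+ X) + (if multiple (suc a) then fallCount a (s ℕ.+ X) else 0ℤ)
        ≡⟨ cong (λ b → climbCount (suc (suc a)) (s ℕ.+ X) + (if b then fallCount a (s ℕ.+ X) else 0ℤ))
                (multiple-< (s≤s z≤n) (ℕP.<-≤-trans (ℕP.m<m+n (suc a) (s≤s z≤n)) bound)) ⟩
          climbCount (suc (suc a)) (s ℕ.+ X) + 0ℤ
        ≡⟨ ℤP.+-identityʳ _ ⟩
          climbCount (suc (suc a)) (s ℕ.+ X)
        ≡⟨ climbCount-skip s (suc a) X (subst (_≤ j) (ℕP.+-suc (suc a) s) bound) ⟩
          climbCount (suc (suc a) ℕ.+ s) X
        ≡⟨ cong (λ b → climbCount b X) (sym (ℕP.+-suc (suc a) s)) ⟩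
          climbCount (suc a ℕ.+ suc s) X
        ∎
        where open ≡-Reasoning

      climbCount-vanishes : ∀ L a → suc a ≤ j → suc a ℕ.+ L < twoJ → climbCount (suc a) L ≡ 0ℤ
      climbCount-vanishes zero    a _    _     = climbCount-zero a
      climbCount-vanishes (suc L) a sa≤j bound with ℕP.m≤n⇒m<n∨m≡n sa≤j
      ... | inj₁ sa<j =
        trans (climbCount-suc a L)
              (trans (cong₂ _+_ (climbCount-vanishes L (suc a) sa<j (subst (_< twoJ) (ℕP.+-suc (suc a) L) bound))
                                (cong (λ b → if b then fallCount a L else 0ℤ) (multiple-< (s≤s z≤n) sa<j)))
                     refl)
      ... | inj₂ refl =
        trans (climbCount-suc j′ L)
              (trans (cong₂ _+_ (trans (climbCount-+j L 0) (trans (cong (climbCount 1) (ℕP.m≤n⇒m∸n≡0 (ℕP.≤-trans (ℕP.n≤1+n L) (ℕP.<⇒≤ L<j)))) (climbCount-zero 0)))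
                                (trans (cong (λ b → if b then fallCount j′ L else 0ℤ) multiple-j)
                                       (trans (fallCount≡delay j′ L) (delay-< j′ _ (ℕP.≤-pred L<j)))))
                     refl)
        where
        L<j : suc L < j
        L<j = ℕP.+-cancelˡ-< j (suc L) j (subst (j ℕ.+ suc L <_) (cong (j ℕ.+_) (ℕP.+-identityʳ j)) bound)

      pyramidCount-< : ∀ {L} → L < twoJ → pyramidCount L m ≡ 0ℤ
      pyramidCount-< {zero}  _     = trans (pyramidCount≡climbCount 0) (climbCount-zero 0)
      pyramidCount-< {suc L} L<2j = trans (pyramidCount≡climbCount (suc L)) (climbCount-vanishes L 0 (s≤s z≤n) L<2j)

      -- Taking one U^j off the leading pyramid ascent and one D^j off the descent after it shortens
      -- the path by 2j; when the ascent is U^j itself, what is left is any path from the same state.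
      pyramidCount-+ : ∀ L → pyramidCount (twoJ ℕ.+ L) m ≡ N⁺ L m + pyramidCount L m
      pyramidCount-+ L =
        begin
          pyramidCount (twoJ ℕ.+ L) m
        ≡⟨ pyramidCount≡climbCount (twoJ ℕ.+ L) ⟩
          climbCount 1 (j′ ℕ.+ (j ℕ.+ 0) ℕ.+ L)
        ≡⟨ cong (climbCount 1) (trans (ℕP.+-assoc j′ (j ℕ.+ 0) L) (cong (λ k → j′ ℕ.+ (k ℕ.+ L)) (ℕP.+-identityʳ j))) ⟩
          climbCount 1 (j′ ℕ.+ (j ℕ.+ L))
        ≡⟨ climbCount-skip j′ 0 (j ℕ.+ L) ℕP.≤-refl ⟩
          climbCount j (suc (j′ ℕ.+ L))
        ≡⟨ climbCount-suc j′ (j′ ℕ.+ L) ⟩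
          climbCount (suc j) (j′ ℕ.+ L) + (if multiple j then fallCount j′ (j′ ℕ.+ L) else 0ℤ)
        ≡⟨ cong₂ _+_ (climbCount-+j (j′ ℕ.+ L) 0)
                     (trans (cong (λ b → if b then fallCount j′ (j′ ℕ.+ L) else 0ℤ) multiple-j)
                            (trans (fallCount≡delay j′ (j′ ℕ.+ L)) (delay-+ j′ (λ L → N⁺ L m) L))) ⟩
          climbCount 1 (j′ ℕ.+ L ∸ j) + N⁺ L m
        ≡⟨ cong (λ k → climbCount 1 k + N⁺ L m) (sym-pred j′ L) ⟩
          climbCount 1 (ℕ.pred L) + N⁺ L m
        ≡⟨ trans (cong (_+ N⁺ L m) (sym (pyramidCount≡climbCount L))) (ℤP.+-comm _ (N⁺ L m)) ⟩
          N⁺ L m + pyramidCount L m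
        ∎
        where
        open ≡-Reasoning
        sym-pred : ∀ k L → k ℕ.+ L ∸ suc k ≡ ℕ.pred L
        sym-pred zero    zero    = refl
        sym-pred zero    (suc L) = refl
        sym-pred (suc k) L       = sym-pred k L

    private
      P O : ℕ → ℕ → ℤ
      P L m = pyramidCount L m
      O L m = otherCount L m

      core : ∀ L₀ m → N⁺ (twoJ ℕ.+ L₀) m ≡ N⁻ (twoJ ℕ.+ L₀) m - N⁻ L₀ m + delay 1 (N⁺ L₀) m
      core L₀ zero =
        begin
          N⁺ L 0
        ≡⟨ N⁺≡ L 0 ⟩
          O L 0 + 0ℤ
        ≡⟨ rearrange (O L 0) (P L₀ 0) (O L₀ 0) ⟩
          O L₀ 0 + 0ℤ + P L₀ 0 + O L 0 - (P L₀ 0 + O L₀ 0) + 0ℤ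
        ≡⟨ cong (λ x → x + P L₀ 0 + O L 0 - (P L₀ 0 + O L₀ 0) + 0ℤ) (sym (N⁺≡ L₀ 0)) ⟩
          N⁺ L₀ 0 + P L₀ 0 + O L 0 - (P L₀ 0 + O L₀ 0) + 0ℤ
        ≡⟨ cong₂ (λ x y → x + O L 0 - y + 0ℤ) (sym (pyramidCount-+ 0 L₀)) (sym (N⁻≡ L₀ 0)) ⟩
          P L 0 + O L 0 - N⁻ L₀ 0 + 0ℤ
        ≡⟨ cong (λ x → x - N⁻ L₀ 0 + 0ℤ) (sym (N⁻≡ L 0)) ⟩
          N⁻ L 0 - N⁻ L₀ 0 + 0ℤ
        ∎
        where
        open ≡-Reasoning
        L = twoJ ℕ.+ L₀
        rearrange : ∀ o p o₀ → o + 0ℤ ≡ o₀ + 0ℤ + p + o - (p + o₀) + 0ℤ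
        rearrange = solve-∀
      core L₀ (suc m′) =
        begin
          N⁺ L m
        ≡⟨ N⁺≡ L m ⟩
          O L m + P L m′
        ≡⟨ cong (O L m +_) (pyramidCount-+ m′ L₀) ⟩
          O L m + (N⁺ L₀ m′ + P L₀ m′)
        ≡⟨ rearrange (O L m) (N⁺ L₀ m′) (P L₀ m′) (P L₀ m) (O L₀ m) ⟩
          O L₀ m + P L₀ m′ + P L₀ m + O L m - (P L₀ m + O L₀ m) + N⁺ L₀ m′
        ≡⟨ cong (λ x → x + P L₀ m + O L m - (P L₀ m + O L₀ m) + N⁺ L₀ m′) (sym (N⁺≡ L₀ m)) ⟩
          N⁺ L₀ m + P L₀ m + O L m - (P L₀ m + O L₀ m) + N⁺ L₀ m′
        ≡⟨ cong₂ (λ x y → x + O L m - y + N⁺ L₀ m′) (sym (pyramidCount-+ m L₀)) (sym (N⁻≡ L₀ m)) ⟩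
          P L m + O L m - N⁻ L₀ m + N⁺ L₀ m′
        ≡⟨ cong (λ x → x - N⁻ L₀ m + N⁺ L₀ m′) (sym (N⁻≡ L m)) ⟩
          N⁻ L m - N⁻ L₀ m + N⁺ L₀ m′
        ∎
        where
        open ≡-Reasoning
        L = twoJ ℕ.+ L₀
        m = suc m′
        rearrange : ∀ o n p′ p o₀ → o + (n + p′) ≡ o₀ + p′ + p + o - (p + o₀) + n
        rearrange = solve-∀

    N⁺-nice : ∀ L m → N⁺ L m ≡ N⁻ L m - delay twoJ (λ L → N⁻ L m) L + delay twoJ (λ L → delay 1 (N⁺ L) m) L
    N⁺-nice L m = <-or-+ twoJ {Recurrence} below above L
      where
      Recurrence : ℕ → Set
      Recurrence L = N⁺ L m ≡ N⁻ L m - delay twoJ (λ L → N⁻ L m) L + delay twoJ (λ L → delay 1 (N⁺ L) m) L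

      below : ∀ {L} → L < twoJ → Recurrence L
      below {L} L<2j =
        begin
          N⁺ L m
        ≡⟨ N⁺≡ L m ⟩
          O L m + delay 1 (P L) m
        ≡⟨ cong (O L m +_) (trans (delay-cong 1 m (λ m′ _ → pyramidCount-< m′ L<2j)) (delay-zero 1 m)) ⟩
          O L m + 0ℤ
        ≡⟨ rearrange (O L m) ⟩
          0ℤ + O L m - 0ℤ + 0ℤ
        ≡⟨ sym (cong₂ (λ x y → x + O L m - y + 0ℤ) (pyramidCount-< m L<2j) (delay-< twoJ _ L<2j)) ⟩
          P L m + O L m - delay twoJ (λ L → N⁻ L m) L + 0ℤ
        ≡⟨ sym (cong₂ (λ x y → x - delay twoJ (λ L → N⁻ L m) L + y) (N⁻≡ L m) (delay-< twoJ _ L<2j)) ⟩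
          N⁻ L m - delay twoJ (λ L → N⁻ L m) L + delay twoJ (λ L → delay 1 (N⁺ L) m) L
        ∎
        where
        open ≡-Reasoning
        rearrange : ∀ o → o + 0ℤ ≡ 0ℤ + o - 0ℤ + 0ℤ
        rearrange = solve-∀

      above : ∀ L₀ → Recurrence (twoJ ℕ.+ L₀)
      above L₀ = trans (core L₀ m) (sym (cong₂ (λ u v → N⁻ (twoJ ℕ.+ L₀) m - u + v)
                                              (delay-+ twoJ (λ L → N⁻ L m) L₀)
                                              (delay-+ twoJ (λ L → delay 1 (N⁺ L) m) L₀)))

  afterDown-cong : ∀ {F G : ℕ → ℤ} h c → (∀ h′ → F h′ ≡ G h′) → afterDown F h c ≡ afterDown G h c
  afterDown-cong zero    c F≗G = refl
  afterDown-cong (suc h) c F≗G = cong (λ x → if multiple c then x else 0ℤ) (F≗G h)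

  -- At a valley no ascent is under way, hence c ≡ 0.
  CountsAgree : ℕ → Set
  CountsAgree L = ∀ h c v m → (v ≡ true → c ≡ 0) → npaCount h c v L m ≡ slotSum h c v L m

  private
    Below : ℕ → Set
    Below L = ∀ {L′} → L′ < L → CountsAgree L′

  notNiceCase : ∀ L → Below L → ∀ h c v m → niceStart h v ≡ false → npaCount h c v L m ≡ slotSum h c v L m
  notNiceCase zero    _  h c v m notNice = npaCount≡slotSum-0 h c v m notNice
  notNiceCase (suc L) ih h c v m notNice =
    trans (npaCount-suc h c v L m notNice)
          (trans (cong₂ _+_ (ih ℕP.≤-refl (suc h) (suc c) false m (λ ()))
                            (afterDown-cong h c (λ h′ → ih ℕP.≤-refl h′ 0 true m (λ _ → refl))))
                 (sym (slotSum-suc h c v L m notNice)))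

  niceCase : ∀ L → Below L → ∀ h m → multiple h ≡ true → npaCount h 0 true L m ≡ slotSum h 0 true L m
  niceCase L ih h m nice =
    trans (NiceStart.N⁺-nice h nice L m)
          (trans (cong₃ (λ x y z → x - y + z)
                        (notNiceCase L ih h 0 false m refl)
                        (delay-cong twoJ L (λ L′ eq → ih (shorter eq) h 0 false m (λ ())))
                        (delay-cong twoJ L (λ L′ eq → delay-cong 1 m (λ m′ _ → ih (shorter eq) h 0 true m′ (λ _ → refl)))))
                 (sym (slotSum-nice h L m nice)))
    where
    shorter : ∀ {L′} → twoJ ℕ.+ L′ ≡ L → L′ < L
    shorter {L′} refl = ℕP.m<n+m L′ ((ℕ.>-nonZero⁻¹ twoJ))
    cong₃ : ∀ (f : ℤ → ℤ → ℤ → ℤ) {x x′ y y′ z z′} → x ≡ x′ → y ≡ y′ → z ≡ z′ → f x y z ≡ f x′ y′ z′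
    cong₃ f refl refl refl = refl

  npaCount≡slotSum : ∀ L → CountsAgree L
  npaCount≡slotSum = <-rec CountsAgree step
    where
    step : ∀ L → Below L → CountsAgree L
    step L ih h c false m _    = notNiceCase L ih h c false m refl
    step L ih h c true  m c≡0 = byMultiple (multiple h) refl
      where
      byMultiple : ∀ b → multiple h ≡ b → npaCount h c true L m ≡ slotSum h c true L m
      byMultiple false notNice = notNiceCase L ih h c true m notNice
      byMultiple true  nice rewrite c≡0 refl = niceCase L ih h m nice

  ≡ᵇ-refl : ∀ n → (n ≡ᵇ n) ≡ true
  ≡ᵇ-refl zero    = refl
  ≡ᵇ-refl (suc n) = ≡ᵇ-refl n

  module Accepted (p : Path) (acc : accepts 0 0 p ≡ true) where

    numDown≡j*landings : numDown p ≡ j ℕ.* landings 0 p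
    numDown≡j*landings =
      trans (sym (accepts⇒+numUp≡numDown 0 0 p acc))
            (sym (trans (landings-invariant 0 0 p acc z≤n) (simplify (numUp p) j)))
      where
      simplify : ∀ u j → u ℕ.+ 0 ℕ.+ j ℕ.* 0 ≡ u
      simplify = ℕSolver.solve-∀

    length≡twoJ*landings : length p ≡ twoJ ℕ.* landings 0 p
    length≡twoJ*landings =
      trans (length≡numUp+numDown p)
            (trans (cong₂ ℕ._+_ (accepts⇒+numUp≡numDown 0 0 p acc) numDown≡j*landings)
                   (trans (cong (ℕ._+ j ℕ.* landings 0 p) numDown≡j*landings) (double j (landings 0 p))))
      where
      double : ∀ a b → a ℕ.* b ℕ.+ a ℕ.* b ≡ 2 ℕ.* a ℕ.* b
      double = ℕSolver.solve-∀

    size≡landings : size j p ≡ landings 0 p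
    size≡landings = trans (cong (_/ j) (trans numDown≡j*landings (ℕP.*-comm j _))) (ℕDM.m*n/n≡m (landings 0 p) j)

    landings≡ : ∀ {n} → length p ≡ twoJ ℕ.* n → landings 0 p ≡ n
    landings≡ {n} ∣p∣≡ = ℕP.*-cancelˡ-≡ (landings 0 p) n twoJ (trans (sym length≡twoJ*landings) ∣p∣≡)

    size≡ : ∀ {n} → length p ≡ twoJ ℕ.* n → size j p ≡ n
    size≡ ∣p∣≡ = trans size≡landings (landings≡ ∣p∣≡)

  npaSeries≡npaCount : ∀ n m → npaSeries j n m ≡ npaCount 0 0 true (twoJ ℕ.* n) m
  npaSeries≡npaCount n m = trans (length-filterB _ (allPaths (twoJ ℕ.* n))) (sumPaths-cong (twoJ ℕ.* n) same)
    where
    same : ∀ p → length p ≡ twoJ ℕ.* n →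
           𝟙 (isJDyck j p ∧ (size j p ≡ᵇ n) ∧ (npa j p ≡ᵇ m)) ≡ 𝟙 (accepts 0 0 p ∧ (nicePyramids 0 true p ≡ᵇ m))
    same p ∣p∣≡ = cong 𝟙 (trans (cong (_∧ ((size j p ≡ᵇ n) ∧ (npa j p ≡ᵇ m))) (isJDyck≡accepts p))
                               (byAcceptance (accepts 0 0 p) refl))
      where
      byAcceptance : ∀ b → accepts 0 0 p ≡ b →
                     b ∧ (size j p ≡ᵇ n) ∧ (npa j p ≡ᵇ m) ≡ b ∧ (nicePyramids 0 true p ≡ᵇ m)
      byAcceptance false _   = refl
      byAcceptance true  acc = trans (cong₂ (λ s k → (s ≡ᵇ n) ∧ (k ≡ᵇ m)) (Accepted.size≡ p acc ∣p∣≡) (npa≡nicePyramids p acc))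
                                     (cong (_∧ (nicePyramids 0 true p ≡ᵇ m)) (≡ᵇ-refl n))

  jDyckCount≡count : ∀ k → jDyckCount j k ≡ count (twoJ ℕ.* k) (accepts 0 0)
  jDyckCount≡count k = trans (length-filterB _ (allPaths (twoJ ℕ.* k))) (sumPaths-cong (twoJ ℕ.* k) same)
    where
    same : ∀ p → length p ≡ twoJ ℕ.* k → 𝟙 (isJDyck j p ∧ (size j p ≡ᵇ k)) ≡ 𝟙 (accepts 0 0 p)
    same p ∣p∣≡ = cong 𝟙 (trans (cong (_∧ (size j p ≡ᵇ k)) (isJDyck≡accepts p)) (byAcceptance (accepts 0 0 p) refl))
      where
      byAcceptance : ∀ b → accepts 0 0 p ≡ b → b ∧ (size j p ≡ᵇ k) ≡ b
      byAcceptance false _   = refl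
      byAcceptance true  acc = trans (cong (_≡ᵇ k) (Accepted.size≡ p acc ∣p∣≡)) (≡ᵇ-refl k)

  twoJ*-%-/ : ∀ a → ((twoJ ℕ.* a) % twoJ ≡ 0) × ((twoJ ℕ.* a) / twoJ ≡ a)
  twoJ*-%-/ a = trans (cong (_% twoJ) (ℕP.*-comm twoJ a)) (ℕDM.m*n%n≡0 a twoJ)
              , trans (cong (_/ twoJ) (ℕP.*-comm twoJ a)) (ℕDM.m*n/n≡m a twoJ)

  Wℓ-twoJ* : ∀ e a m → Wℓ e (twoJ ℕ.* a) m ≡ powS W e a m
  Wℓ-twoJ* e a m rewrite proj₁ (twoJ*-%-/ a) | proj₂ (twoJ*-%-/ a) = refl

  slotSum≡ : ∀ n m → slotSum 0 0 true (twoJ ℕ.* n) m ≡ sumTo n (λ k → jDyckCount j k * powS W (suc k) (n ∸ k) m)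
  slotSum≡ n m =
    begin
      slotSum 0 0 true N m
    ≡⟨ sumTo-cong N (λ L′ → trans (sumPaths-cong L′ (byLength L′)) (sumOver-*ʳ (allPaths L′) (𝟙 ∘ accepts 0 0) (weight L′))) ⟩
      sumTo N (λ L′ → count L′ (accepts 0 0) * weight L′)
    ≡⟨ sumTo-multiples (j′ ℕ.+ suc (j′ ℕ.+ 0)) n (λ L′ → count L′ (accepts 0 0) * weight L′) vanishes ⟩
      sumTo n (λ k → count (twoJ ℕ.* k) (accepts 0 0) * weight (twoJ ℕ.* k))
    ≡⟨ sumTo-cong n (λ k → cong₂ _*_ (sym (jDyckCount≡count k)) (atMultiple k)) ⟩
      sumTo n (λ k → jDyckCount j k * powS W (suc k) (n ∸ k) m)
    ∎
    where
    open ≡-Reasoning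
    N = twoJ ℕ.* n

    weight : ℕ → ℤ
    weight L′ = if L′ % twoJ ≡ᵇ 0 then Wℓ (suc (L′ / twoJ)) (N ∸ L′) m else 0ℤ

    weight-twoJ* : ∀ a → weight (twoJ ℕ.* a) ≡ Wℓ (suc a) (N ∸ twoJ ℕ.* a) m
    weight-twoJ* a rewrite proj₁ (twoJ*-%-/ a) | proj₂ (twoJ*-%-/ a) = refl

    byLength : ∀ L′ Q → length Q ≡ L′ →
               (if accepts 0 0 Q then Wℓ (slots 0 true Q) (N ∸ L′) m else 0ℤ) ≡ 𝟙 (accepts 0 0 Q) * weight L′
    byLength L′ Q ∣Q∣≡ with accepts 0 0 Q in acc
    ... | false = sym (ℤP.*-zeroˡ (weight L′))
    ... | true  = trans (cong (λ L → Wℓ (suc (landings 0 Q)) (N ∸ L) m) (sym ∣Q∣≡landings))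
                 (trans (sym (weight-twoJ* (landings 0 Q)))
                 (trans (cong weight ∣Q∣≡landings) (sym (ℤP.*-identityˡ (weight L′)))))
      where
      ∣Q∣≡landings : twoJ ℕ.* landings 0 Q ≡ L′
      ∣Q∣≡landings = trans (sym (Accepted.length≡twoJ*landings Q acc)) ∣Q∣≡

    offMultiple : ∀ k r → r < j′ ℕ.+ suc (j′ ℕ.+ 0) → weight (suc (r ℕ.+ twoJ ℕ.* k)) ≡ 0ℤ
    offMultiple k r r<d =
      cong (λ x → if x ≡ᵇ 0 then Wℓ (suc (L / twoJ)) (N ∸ L) m else 0ℤ)
           (trans (cong (λ i → (suc r ℕ.+ i) % twoJ) (ℕP.*-comm twoJ k))
                  (trans (ℕDM.[m+kn]%n≡m%n (suc r) k twoJ) (ℕDM.m<n⇒m%n≡m (s≤s r<d))))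
      where L = suc (r ℕ.+ twoJ ℕ.* k)

    vanishes : ∀ k r → r < j′ ℕ.+ suc (j′ ℕ.+ 0) →
               count (suc (r ℕ.+ twoJ ℕ.* k)) (accepts 0 0) * weight (suc (r ℕ.+ twoJ ℕ.* k)) ≡ 0ℤ
    vanishes k r r<d = trans (cong (count (suc (r ℕ.+ twoJ ℕ.* k)) (accepts 0 0) *_) (offMultiple k r r<d))
                             (ℤP.*-zeroʳ (count (suc (r ℕ.+ twoJ ℕ.* k)) (accepts 0 0)))

    atMultiple : ∀ k → weight (twoJ ℕ.* k) ≡ powS W (suc k) (n ∸ k) m
    atMultiple k = trans (weight-twoJ* k)
                         (trans (cong (λ i → Wℓ (suc k) i m) (sym (ℕP.*-distribˡ-∸ twoJ n k))) (Wℓ-twoJ* (suc k) (n ∸ k) m))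

lemma6 : (j : ℕ) → .{{_ : NonZero j}} → (n m : ℕ) →
    Φ (jDyckCount j) n m ≡ npaSeries j n m
lemma6 zero     n m = ⊥-elim (ℕ.≢-nonZero⁻¹ 0 refl)
lemma6 (suc j′) n m =
  begin
    Φ (jDyckCount (suc j′)) n m
  ≡⟨ Φ-coeff (jDyckCount (suc j′)) n m ⟩
    sumTo n (λ k → jDyckCount (suc j′) k * powS W (suc k) (n ∸ k) m)
  ≡⟨ sym (slotSum≡ n m) ⟩
    slotSum 0 0 true (twoJ ℕ.* n) m
  ≡⟨ sym (npaCount≡slotSum (twoJ ℕ.* n) 0 0 true m (λ _ → refl)) ⟩
    npaCount 0 0 true (twoJ ℕ.* n) m
  ≡⟨ sym (npaSeries≡npaCount n m) ⟩
    npaSeries (suc j′) n m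
  ∎
  where
  open Counting j′
  open ≡-Reasoning
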